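{- Let $A\geq a\geq 1$ and $r\geq 2$ be integers. Then \[ \sum_{\pi\in\overline{\mathcal{P}}}z^{\overline{mes}_{r,A,a}(\pi)}q^{|\pi|} =\frac{(-q;q)_{\infty}}{(q;q)_{\infty}}\sum_{k=0}^{\infty}z^{kA+a}\bigg[\frac{q^{r[A\binom{k}{2}+ka]}}{(-q^a;q^A)_k}-\frac{q^{r[A\binom{k+1}{2}+(k+1)a]}}{(-q^a;q^A)_{k+1}}\bigg]. \]
   Context: An overpartition is a partition (finite non-increasing sequence of positive integers) in which the first occurrence of each part value may be overlined; $\overline{\mathcal{P}}$ is the set of all overpartitions and $|\pi|$ the sum of parts. A part is of size $t$ if it equals $t$ or $\overline{t}$. $(a;q)_\infty=\prod_{i\geq0}(1-aq^i)$, $(a;q)_n=(a;q)_\infty/(aq^n;q)_\infty$; $|q|<1$, $z$ a formal variable. For $r\geq2$, $\overline{mes}_{r,A,a}(\pi)$ is the smallest positive integer $m\equiv a\pmod A$ such that either $\pi$ has no overlined part $\overline{m}$ or $\pi$ has fewer than $r-1$ non-overlined parts equal to $m$. -}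

module Defs where

open import Data.Nat as ℕ using (ℕ; zero; suc; _≤_; _<_; _≡ᵇ_; _<ᵇ_)
open import Data.Nat.Combinatorics using (_C_)
open import Data.Integer as ℤ using (ℤ; +_)
open import Data.Bool using (Bool; true; false; if_then_else_; _∨_)
open import Data.List using (List; []; _∷_; map)
open import Data.Nat.ListAction using (sum)
open import Data.Product using (_×_; _,_; proj₁)
open import Data.Sum using (_⊎_)
open import Data.Unit using (⊤)
open import Relation.Binary.PropositionalEquality using (_≡_)

-- Formal power series in q with integer coefficients: coefficient maps.

Series : Set
Series = ℕ → ℤ

sumTo : ℕ → (ℕ → ℤ) → ℤ
sumTo zero    f = f 0
sumTo (suc n) f = sumTo n f ℤ.+ f (suc n)

δ : ℕ → ℕ → ℤ
δ i j = if i ≡ᵇ j then + 1 else + 0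

monoS : ℕ → Series
monoS e n = δ e n

oneS : Series
oneS = monoS 0

_⊕_ : Series → Series → Series
(f ⊕ g) n = f n ℤ.+ g n

_⊖_ : Series → Series → Series
(f ⊖ g) n = f n ℤ.- g n

_⊛_ : Series → Series → Series
(f ⊛ g) n = sumTo n (λ i → f i ℤ.* g (n ℕ.∸ i))

infixl 7 _⊛_
infixl 6 _⊕_ _⊖_

-- 1 / (1 - c q^e) = Σ_{j ≥ 0} c^j q^{e j}   (used with e ≥ 1)
geomS : ℤ → ℕ → Series
geomS c e n = sumTo n (λ j → δ (e ℕ.* j) n ℤ.* (c ℤ.^ j))

prodFrom1 : (ℕ → Series) → ℕ → Series
prodFrom1 F zero    = oneS
prodFrom1 F (suc N) = prodFrom1 F N ⊛ F (suc N)

prodLt : (ℕ → Series) → ℕ → Series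
prodLt F zero    = oneS
prodLt F (suc k) = prodLt F k ⊛ F k

-- Infinite product ∏_{i ≥ 1} F i, where each F i ≡ 1 (mod q^i):
-- the coefficient of q^n only depends on the factors i ≤ n.
infProd : (ℕ → Series) → Series
infProd F n = prodFrom1 F n n

minusQInf : Series
minusQInf = infProd (λ i → oneS ⊕ monoS i)

-- 1/(q;q)_∞ = ∏_{i≥1} 1/(1 - q^i)
invQInf : Series
invQInf = infProd (λ i → geomS (+ 1) i)

-- 1/(-q^a;q^A)_k = ∏_{j<k} 1/(1 + q^{a+jA})
invPoch : ℕ → ℕ → ℕ → Series
invPoch A a k = prodLt (λ j → geomS (ℤ.- (+ 1)) (a ℕ.+ j ℕ.* A)) k

Dterm : ℕ → ℕ → ℕ → ℕ → Series
Dterm r A a k = monoS (r ℕ.* (A ℕ.* (k C 2) ℕ.+ k ℕ.* a)) ⊛ invPoch A a k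

-- coefficient series of z^{kA+a} on the right-hand side
rhsTerm : ℕ → ℕ → ℕ → ℕ → Series
rhsTerm r A a k = (minusQInf ⊛ invQInf) ⊛ (Dterm r A a k ⊖ Dterm r A a (suc k))

-- Overpartitions: lists of (size, overlined?) pairs, in non-increasing
-- order of size; among equal sizes only the first may be overlined.

RawOP : Set
RawOP = List (ℕ × Bool)

IsOverpartition : RawOP → Set
IsOverpartition []                             = ⊤
IsOverpartition ((s , b) ∷ [])                 = 1 ≤ s
IsOverpartition ((s , b) ∷ (s' , b') ∷ rest) =
  1 ≤ s × (s' < s ⊎ (s' ≡ s × b' ≡ false)) × IsOverpartition ((s' , b') ∷ rest)

size : RawOP → ℕ
size π = sum (map proj₁ π)

sameB : Bool → Bool → Bool
sameB true  true  = true
sameB false false = true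
sameB _     _     = false

cnt : ℕ → Bool → RawOP → ℕ
cnt t b []              = 0
cnt t b ((s , b') ∷ π) =
  if (s ≡ᵇ t) Data.Bool.∧ sameB b b' then suc (cnt t b π) else cnt t b π

qualifies : ℕ → ℕ → RawOP → Bool
qualifies r m π = (cnt m true π ≡ᵇ 0) ∨ (cnt m false π <ᵇ (r ℕ.∸ 1))

findK : ℕ → ℕ → ℕ → ℕ → RawOP → ℕ → ℕ
findK r A a zero       π k = k
findK r A a (suc fuel) π k =
  if qualifies r (a ℕ.+ k ℕ.* A) π then k else findK r A a fuel π (suc k)

-- mes_{r,A,a}(π): the positive integers ≡ a (mod A) are a, a+A, a+2A, ...
-- (as 1 ≤ a ≤ A); a + kA with k = |π| exceeds every part, so the search
-- over k = 0..|π| always succeeds.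
mes : ℕ → ℕ → ℕ → RawOP → ℕ
mes r A a π = a ℕ.+ findK r A a (suc (size π)) π 0 ℕ.* A

-- Write m_j = a + jA, so that mes π is the first m_j that qualifies. Hence mes π ≥ m_k exactly
-- when each m_j, j < k, is saturated in π: π has an overlined part m_j and at least r − 1 plain
-- parts m_j. Building overpartitions one part size t at a time, the multiplicities of a free size
-- contribute (1 + q^t)/(1 − q^t), and those of a saturated size contribute
-- q^{rt}/(1 − q^t) = (1 + q^t)/(1 − q^t) · q^{rt}/(1 + q^t). So the overpartitions with mes π ≥ m_k
-- have generating function (−q;q)_∞/(q;q)_∞ · q^{r[A·C(k,2) + ka]}/(−q^a;q^A)_k, and those with
-- mes π = m_k are the difference between the cases k and k + 1.

module Submission where

open import Defs
open import Data.Nat using (ℕ)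
open import Relation.Binary.PropositionalEquality

module FiniteSums where

  open import Data.Nat as ℕ using (ℕ; zero; suc; _≤_; z≤n; s≤s)
  import Data.Nat.Properties as ℕₚ
  open import Data.Integer using (ℤ; +_; _+_; _*_)
  import Data.Integer.Properties as ℤₚ
  open import Data.Integer.Tactic.RingSolver using (solve-∀)
  open import Function using (_∘_)
  open import Relation.Nullary using (yes; no)
  open ≡-Reasoning

  sumTo-cong : ∀ n {f g : ℕ → ℤ} → (∀ i → i ≤ n → f i ≡ g i) → sumTo n f ≡ sumTo n g
  sumTo-cong zero    f≡g = f≡g 0 z≤n
  sumTo-cong (suc n) f≡g =
    cong₂ _+_ (sumTo-cong n (λ i i≤n → f≡g i (ℕₚ.m≤n⇒m≤1+n i≤n))) (f≡g (suc n) ℕₚ.≤-refl)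

  sumTo-zero : ∀ n {f : ℕ → ℤ} → (∀ i → i ≤ n → f i ≡ + 0) → sumTo n f ≡ + 0
  sumTo-zero zero    f≡0 = f≡0 0 z≤n
  sumTo-zero (suc n) f≡0 =
    cong₂ _+_ (sumTo-zero n (λ i i≤n → f≡0 i (ℕₚ.m≤n⇒m≤1+n i≤n))) (f≡0 (suc n) ℕₚ.≤-refl)

  sumTo-single : ∀ n k {f : ℕ → ℤ} → k ≤ n → (∀ i → i ≤ n → i ≢ k → f i ≡ + 0) →
    sumTo n f ≡ f k
  sumTo-single zero .zero z≤n _ = refl
  sumTo-single (suc n) k {f} k≤1+n f≡0 with k ℕ.≟ suc n
  ... | yes refl = begin
    sumTo n f + f (suc n) ≡⟨ cong (_+ f (suc n)) (sumTo-zero n below-zero) ⟩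
    + 0 + f (suc n)       ≡⟨ ℤₚ.+-identityˡ _ ⟩
    f (suc n)             ∎
    where
    below-zero : ∀ i → i ≤ n → f i ≡ + 0
    below-zero i i≤n = f≡0 i (ℕₚ.m≤n⇒m≤1+n i≤n) (λ { refl → ℕₚ.<-irrefl refl (s≤s i≤n) })
  ... | no k≢1+n = begin
    sumTo n f + f (suc n) ≡⟨ cong₂ _+_ (sumTo-single n k k≤n (λ i i≤n → f≡0 i (ℕₚ.m≤n⇒m≤1+n i≤n)))
                                        (f≡0 (suc n) ℕₚ.≤-refl (k≢1+n ∘ sym)) ⟩
    f k + + 0             ≡⟨ ℤₚ.+-identityʳ _ ⟩
    f k                   ∎
    where k≤n = ℕₚ.≤-pred (ℕₚ.≤∧≢⇒< k≤1+n k≢1+n)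

  sumTo-+ : ∀ n (f g : ℕ → ℤ) → sumTo n (λ i → f i + g i) ≡ sumTo n f + sumTo n g
  sumTo-+ zero    f g = refl
  sumTo-+ (suc n) f g =
    trans (cong (_+ (f (suc n) + g (suc n))) (sumTo-+ n f g)) (+-interchange (sumTo n f) (sumTo n g) _ _)
    where
    +-interchange : ∀ a b c d → (a + b) + (c + d) ≡ (a + c) + (b + d)
    +-interchange = solve-∀

  *-distribˡ-sumTo : ∀ n (c : ℤ) (f : ℕ → ℤ) → c * sumTo n f ≡ sumTo n (λ i → c * f i)
  *-distribˡ-sumTo zero    c f = refl
  *-distribˡ-sumTo (suc n) c f =
    trans (ℤₚ.*-distribˡ-+ c (sumTo n f) (f (suc n))) (cong (_+ c * f (suc n)) (*-distribˡ-sumTo n c f))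

  *-distribʳ-sumTo : ∀ n (c : ℤ) (f : ℕ → ℤ) → sumTo n f * c ≡ sumTo n (λ i → f i * c)
  *-distribʳ-sumTo n c f = begin
    sumTo n f * c                ≡⟨ ℤₚ.*-comm (sumTo n f) c ⟩
    c * sumTo n f                ≡⟨ *-distribˡ-sumTo n c f ⟩
    sumTo n (λ i → c * f i)      ≡⟨ sumTo-cong n (λ i _ → ℤₚ.*-comm c (f i)) ⟩
    sumTo n (λ i → f i * c)      ∎

  sumTo-suc : ∀ n (f : ℕ → ℤ) → sumTo (suc n) f ≡ f 0 + sumTo n (f ∘ suc)
  sumTo-suc zero    f = refl
  sumTo-suc (suc n) f = begin
    sumTo (suc n) f + f (suc (suc n))           ≡⟨ cong (_+ f (suc (suc n))) (sumTo-suc n f) ⟩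
    f 0 + sumTo n (f ∘ suc) + f (suc (suc n))   ≡⟨ ℤₚ.+-assoc (f 0) _ _ ⟩
    f 0 + sumTo (suc n) (f ∘ suc)               ∎

  sumTo-reverse : ∀ n (f : ℕ → ℤ) → sumTo n f ≡ sumTo n (λ i → f (n ℕ.∸ i))
  sumTo-reverse zero    f = refl
  sumTo-reverse (suc n) f = begin
    sumTo n f + f (suc n)                       ≡⟨ cong (_+ f (suc n)) (sumTo-reverse n f) ⟩
    sumTo n (λ i → f (n ℕ.∸ i)) + f (suc n)     ≡⟨ ℤₚ.+-comm _ (f (suc n)) ⟩
    f (suc n) + sumTo n (λ i → f (n ℕ.∸ i))     ≡⟨ sym (sumTo-suc n (λ i → f (suc n ℕ.∸ i))) ⟩
    sumTo (suc n) (λ i → f (suc n ℕ.∸ i))       ∎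

  sumTo-triangle : ∀ n (T : ℕ → ℕ → ℤ) →
    sumTo n (λ i → sumTo i (T i)) ≡ sumTo n (λ j → sumTo (n ℕ.∸ j) (λ l → T (j ℕ.+ l) j))
  sumTo-triangle zero    T = refl
  sumTo-triangle (suc n) T = begin
    sumTo n (λ i → sumTo i (T i)) + sumTo (suc n) (T (suc n))
      ≡⟨ cong (_+ sumTo (suc n) (T (suc n))) (sumTo-triangle n T) ⟩
    Cols n + (sumTo n (T (suc n)) + T (suc n) (suc n))
      ≡⟨ sym (ℤₚ.+-assoc (Cols n) _ _) ⟩
    Cols n + sumTo n (T (suc n)) + T (suc n) (suc n)
      ≡⟨ cong₂ _+_ (sym (sumTo-+ n _ _)) (sym last-column) ⟩
    sumTo n (λ j → sumTo (n ℕ.∸ j) (λ l → T (j ℕ.+ l) j) + T (suc n) j)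
      + sumTo (suc n ℕ.∸ suc n) (λ l → T (suc n ℕ.+ l) (suc n))
      ≡⟨ cong (_+ sumTo (suc n ℕ.∸ suc n) (λ l → T (suc n ℕ.+ l) (suc n))) (sumTo-cong n extend-column) ⟩
    Cols (suc n) ∎
    where
    Cols : ℕ → ℤ
    Cols n = sumTo n (λ j → sumTo (n ℕ.∸ j) (λ l → T (j ℕ.+ l) j))
    last-column : sumTo (suc n ℕ.∸ suc n) (λ l → T (suc n ℕ.+ l) (suc n)) ≡ T (suc n) (suc n)
    last-column rewrite ℕₚ.n∸n≡0 n | ℕₚ.+-identityʳ n = refl
    extend-column : ∀ j → j ≤ n → sumTo (n ℕ.∸ j) (λ l → T (j ℕ.+ l) j) + T (suc n) j
                                ≡ sumTo (suc n ℕ.∸ j) (λ l → T (j ℕ.+ l) j)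
    extend-column j j≤n rewrite ℕₚ.+-∸-assoc 1 j≤n =
      cong (λ i → sumTo (n ℕ.∸ j) (λ l → T (j ℕ.+ l) j) + T i j)
        (sym (trans (ℕₚ.+-suc j (n ℕ.∸ j)) (cong suc (ℕₚ.m+[n∸m]≡n j≤n))))

open FiniteSums

module PowerSeries where

  open import Data.Nat as ℕ using (ℕ; _≤_; _<_; z≤n)
  import Data.Nat.Properties as ℕₚ
  open import Data.Integer using (ℤ; +_; _+_; _*_; _-_; -1ℤ)
  import Data.Integer.Properties as ℤₚ
  open import Data.Integer.Tactic.RingSolver using (solve-∀)
  open import Data.Product using (_,_)
  open import Algebra.Bundles using (CommutativeMonoid)
  import Algebra.Properties.CommutativeSemigroup as CommutativeSemigroupProperties
  open import Relation.Binary.Bundles using (Setoid)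
  open import Relation.Nullary using (yes; no)
  open import Relation.Nullary.Decidable using (dec-true; dec-false)
  open import Function using (_∘_)
  open ≡-Reasoning

  infix 4 _≗[_]_
  _≗[_]_ : Series → ℕ → Series → Set
  f ≗[ N ] g = ∀ i → i ≤ N → f i ≡ g i

  ⊛-comm : ∀ f g → f ⊛ g ≗ g ⊛ f
  ⊛-comm f g n = trans (sumTo-reverse n _) (sumTo-cong n λ i i≤n →
    trans (cong (λ j → f (n ℕ.∸ i) * g j) (ℕₚ.m∸[m∸n]≡n i≤n)) (ℤₚ.*-comm (f (n ℕ.∸ i)) (g i)))

  ⊛-assoc : ∀ f g h → (f ⊛ g) ⊛ h ≗ f ⊛ (g ⊛ h)
  ⊛-assoc f g h n = begin
    sumTo n (λ i → sumTo i (λ j → f j * g (i ℕ.∸ j)) * h (n ℕ.∸ i))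
      ≡⟨ sumTo-cong n (λ i _ → *-distribʳ-sumTo i (h (n ℕ.∸ i)) _) ⟩
    sumTo n (λ i → sumTo i (λ j → f j * g (i ℕ.∸ j) * h (n ℕ.∸ i)))
      ≡⟨ sumTo-triangle n (λ i j → f j * g (i ℕ.∸ j) * h (n ℕ.∸ i)) ⟩
    sumTo n (λ j → sumTo (n ℕ.∸ j) (λ l → f j * g ((j ℕ.+ l) ℕ.∸ j) * h (n ℕ.∸ (j ℕ.+ l))))
      ≡⟨ sumTo-cong n (λ j _ → sumTo-cong (n ℕ.∸ j) (λ l _ → reindex j l)) ⟩
    sumTo n (λ j → sumTo (n ℕ.∸ j) (λ l → f j * (g l * h ((n ℕ.∸ j) ℕ.∸ l))))
      ≡⟨ sumTo-cong n (λ j _ → sym (*-distribˡ-sumTo (n ℕ.∸ j) (f j) _)) ⟩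
    sumTo n (λ j → f j * sumTo (n ℕ.∸ j) (λ l → g l * h ((n ℕ.∸ j) ℕ.∸ l))) ∎
    where
    reindex : ∀ j l → f j * g ((j ℕ.+ l) ℕ.∸ j) * h (n ℕ.∸ (j ℕ.+ l))
                    ≡ f j * (g l * h ((n ℕ.∸ j) ℕ.∸ l))
    reindex j l rewrite ℕₚ.m+n∸m≡n j l | sym (ℕₚ.∸-+-assoc n j l) = ℤₚ.*-assoc (f j) _ _

  ⊛-cong : ∀ {f f′ g g′} → f ≗ f′ → g ≗ g′ → f ⊛ g ≗ f′ ⊛ g′
  ⊛-cong f≗f′ g≗g′ n = sumTo-cong n (λ i _ → cong₂ _*_ (f≗f′ i) (g≗g′ (n ℕ.∸ i)))

  ⊛-congˡ : ∀ f {g g′} → g ≗ g′ → f ⊛ g ≗ f ⊛ g′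
  ⊛-congˡ f = ⊛-cong {f} (λ _ → refl)

  ⊛-congʳ : ∀ {f f′} g → f ≗ f′ → f ⊛ g ≗ f′ ⊛ g
  ⊛-congʳ g f≗f′ = ⊛-cong {g = g} f≗f′ (λ _ → refl)

  ⊛-cong-≤ : ∀ {f f′ g g′} N → f ≗[ N ] f′ → g ≗[ N ] g′ → f ⊛ g ≗[ N ] f′ ⊛ g′
  ⊛-cong-≤ N f≗f′ g≗g′ i i≤N = sumTo-cong i (λ j j≤i →
    cong₂ _*_ (f≗f′ j (ℕₚ.≤-trans j≤i i≤N)) (g≗g′ (i ℕ.∸ j) (ℕₚ.≤-trans (ℕₚ.m∸n≤m i j) i≤N)))

  ⊛-distribʳ-⊕ : ∀ f g h → (f ⊕ g) ⊛ h ≗ f ⊛ h ⊕ g ⊛ h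
  ⊛-distribʳ-⊕ f g h n =
    trans (sumTo-cong n (λ i _ → ℤₚ.*-distribʳ-+ (h (n ℕ.∸ i)) (f i) (g i))) (sumTo-+ n _ _)

  ⊛-distribˡ-⊖ : ∀ f g h → f ⊛ (g ⊖ h) ≗ f ⊛ g ⊖ f ⊛ h
  ⊛-distribˡ-⊖ f g h n = begin
    sumTo n (λ i → f i * (g (n ℕ.∸ i) - h (n ℕ.∸ i)))
      ≡⟨ sumTo-cong n (λ i _ → *-distrib-- (f i) (g (n ℕ.∸ i)) (h (n ℕ.∸ i))) ⟩
    sumTo n (λ i → f i * g (n ℕ.∸ i) + -1ℤ * (f i * h (n ℕ.∸ i)))
      ≡⟨ sumTo-+ n _ _ ⟩
    (f ⊛ g) n + sumTo n (λ i → -1ℤ * (f i * h (n ℕ.∸ i)))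
      ≡⟨ cong (_+_ ((f ⊛ g) n)) (sym (*-distribˡ-sumTo n -1ℤ _)) ⟩
    (f ⊛ g) n + -1ℤ * (f ⊛ h) n
      ≡⟨ cong (_+_ ((f ⊛ g) n)) (ℤₚ.-1*i≡-i ((f ⊛ h) n)) ⟩
    (f ⊛ g) n - (f ⊛ h) n ∎
    where
    *-distrib-- : ∀ x y z → x * (y - z) ≡ x * y + -1ℤ * (x * z)
    *-distrib-- = solve-∀

  δ-refl : ∀ i → δ i i ≡ + 1
  δ-refl i rewrite dec-true (i ℕ.≟ i) refl = refl

  δ-≢ : ∀ i j → i ≢ j → δ i j ≡ + 0
  δ-≢ i j i≢j rewrite dec-false (i ℕ.≟ j) i≢j = refl

  monoS-⊛ : ∀ e f n → e ≤ n → (monoS e ⊛ f) n ≡ f (n ℕ.∸ e)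
  monoS-⊛ e f n e≤n = begin
    sumTo n (λ i → δ e i * f (n ℕ.∸ i))
      ≡⟨ sumTo-single n e e≤n (λ i _ i≢e → trans (cong (_* f (n ℕ.∸ i)) (δ-≢ e i (i≢e ∘ sym)))
                                                   (ℤₚ.*-zeroˡ (f (n ℕ.∸ i)))) ⟩
    δ e e * f (n ℕ.∸ e)
      ≡⟨ cong (_* f (n ℕ.∸ e)) (δ-refl e) ⟩
    + 1 * f (n ℕ.∸ e)
      ≡⟨ ℤₚ.*-identityˡ _ ⟩
    f (n ℕ.∸ e) ∎

  monoS-⊛-< : ∀ e f n → n < e → (monoS e ⊛ f) n ≡ + 0
  monoS-⊛-< e f n n<e = sumTo-zero n (λ i i≤n →
    trans (cong (_* f (n ℕ.∸ i)) (δ-≢ e i λ { refl → ℕₚ.<-irrefl refl (ℕₚ.<-≤-trans n<e i≤n) }))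
          (ℤₚ.*-zeroˡ (f (n ℕ.∸ i))))

  ⊛-identityˡ : ∀ f → oneS ⊛ f ≗ f
  ⊛-identityˡ f n = monoS-⊛ 0 f n z≤n

  ⊛-identityʳ : ∀ f → f ⊛ oneS ≗ f
  ⊛-identityʳ f n = trans (⊛-comm f oneS n) (⊛-identityˡ f n)

  monoS-+ : ∀ x y → monoS (x ℕ.+ y) ≗ monoS x ⊛ monoS y
  monoS-+ x y n with x ℕ.≤? n
  ... | yes x≤n = trans coeff (sym (monoS-⊛ x (monoS y) n x≤n))
    where
    coeff : δ (x ℕ.+ y) n ≡ δ y (n ℕ.∸ x)
    coeff with y ℕ.≟ n ℕ.∸ x
    ... | yes refl rewrite ℕₚ.m+[n∸m]≡n x≤n = trans (δ-refl n) (sym (δ-refl (n ℕ.∸ x)))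
    ... | no y≢n∸x = trans (δ-≢ _ _ (λ x+y≡n → y≢n∸x (trans (sym (ℕₚ.m+n∸m≡n x y)) (cong (ℕ._∸ x) x+y≡n))))
                           (sym (δ-≢ _ _ y≢n∸x))
  ... | no x≰n = trans (δ-≢ _ _ (λ x+y≡n → x≰n (subst (x ≤_) x+y≡n (ℕₚ.m≤m+n x y))))
                       (sym (monoS-⊛-< x (monoS y) n (ℕₚ.≰⇒> x≰n)))

  ⊛-commutativeMonoid : CommutativeMonoid _ _
  ⊛-commutativeMonoid = record
    { _≈_ = _≗_
    ; _∙_ = _⊛_
    ; ε = oneS
    ; isCommutativeMonoid = record
      { isMonoid = record
        { isSemigroup = record
          { isMagma = record
            { isEquivalence = Setoid.isEquivalence (ℕ →-setoid ℤ)
            ; ∙-cong = ⊛-cong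
            }
          ; assoc = ⊛-assoc
          }
        ; identity = ⊛-identityˡ , ⊛-identityʳ
        }
      ; comm = ⊛-comm
      }
    }

  open CommutativeSemigroupProperties (CommutativeMonoid.commutativeSemigroup ⊛-commutativeMonoid) public
    using (interchange; xy∙z≈xz∙y)

open PowerSeries

module SeriesOnMultiples where

  open import Data.Nat as ℕ using (ℕ; zero; suc; _≤_; _<_; _≤ᵇ_)
  import Data.Nat.Properties as ℕₚ
  open import Function using (_∘_)
  open import Data.Nat.Divisibility using (_∣_; divides; divides-refl; _∣?_; _∣0; n∣m*n; ∣m∸n∣n⇒∣m; ∣⇒≤)
  open import Data.Integer using (ℤ; +_; _+_; _*_; _^_; 1ℤ; -1ℤ)
  import Data.Integer.Properties as ℤₚ
  open import Data.Integer.Tactic.RingSolver using (solve-∀)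
  open import Data.Bool using (true; false; if_then_else_)
  open import Relation.Nullary using (¬_; yes; no; contradiction)
  open import Relation.Nullary.Decidable using (dec-true; dec-false)
  open ≡-Reasoning

  -- Σ_e w e q^{s e}; note that geomS c s is onMultiples s (c ^_).
  onMultiples : ℕ → (ℕ → ℤ) → Series
  onMultiples s w n = sumTo n (λ j → δ (s ℕ.* j) n * w j)

  onMultiples-at : ∀ s w e → onMultiples (suc s) w (e ℕ.* suc s) ≡ w e
  onMultiples-at s w e = begin
    sumTo (e ℕ.* suc s) (λ j → δ (suc s ℕ.* j) (e ℕ.* suc s) * w j)
      ≡⟨ sumTo-single (e ℕ.* suc s) e (ℕₚ.m≤m*n e (suc s)) (λ j _ j≢e →
           trans (cong (_* w j) (δ-≢ _ _ (j≢e ∘ cancel j))) (ℤₚ.*-zeroˡ (w j))) ⟩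
    δ (suc s ℕ.* e) (e ℕ.* suc s) * w e
      ≡⟨ cong (λ x → δ x (e ℕ.* suc s) * w e) (ℕₚ.*-comm (suc s) e) ⟩
    δ (e ℕ.* suc s) (e ℕ.* suc s) * w e
      ≡⟨ cong (_* w e) (δ-refl (e ℕ.* suc s)) ⟩
    + 1 * w e
      ≡⟨ ℤₚ.*-identityˡ (w e) ⟩
    w e ∎
    where
    cancel : ∀ j → suc s ℕ.* j ≡ e ℕ.* suc s → j ≡ e
    cancel j eq = ℕₚ.*-cancelʳ-≡ j e (suc s) (trans (ℕₚ.*-comm j (suc s)) eq)

  onMultiples-off : ∀ s w n → ¬ s ∣ n → onMultiples s w n ≡ + 0
  onMultiples-off s w n s∤n = sumTo-zero n (λ j _ →
    trans (cong (_* w j) (δ-≢ _ _ (λ sj≡n → s∤n (divides j (trans (sym sj≡n) (ℕₚ.*-comm s j))))))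
          (ℤₚ.*-zeroˡ (w j)))

  ≗-onMultiples : ∀ s w (f : Series) → (∀ e → f (e ℕ.* suc s) ≡ w e) →
    (∀ n → ¬ suc s ∣ n → f n ≡ + 0) → f ≗ onMultiples (suc s) w
  ≗-onMultiples s w f f-at f-off n with suc s ∣? n
  ... | yes (divides-refl e) = trans (f-at e) (sym (onMultiples-at s w e))
  ... | no s∤n = trans (f-off n s∤n) (sym (onMultiples-off (suc s) w n s∤n))

  onMultiples-cong : ∀ s {w v} → (∀ e → w e ≡ v e) → onMultiples s w ≗ onMultiples s v
  onMultiples-cong s w≡v n = sumTo-cong n (λ j _ → cong (δ (s ℕ.* j) n *_) (w≡v j))

  onMultiples-+ : ∀ s w v → onMultiples s w ⊕ onMultiples s v ≗ onMultiples s (λ e → w e + v e)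
  onMultiples-+ s w v n = trans (sym (sumTo-+ n _ _))
    (sumTo-cong n (λ j _ → sym (ℤₚ.*-distribˡ-+ (δ (s ℕ.* j) n) (w j) (v j))))

  delay : ℕ → (ℕ → ℤ) → ℕ → ℤ
  delay k w e = if k ≤ᵇ e then w (e ℕ.∸ k) else + 0

  monoS-⊛-onMultiples : ∀ s k w →
    monoS (k ℕ.* suc s) ⊛ onMultiples (suc s) w ≗ onMultiples (suc s) (delay k w)
  monoS-⊛-onMultiples s k w = ≗-onMultiples s (delay k w) (monoS (k ℕ.* S) ⊛ onMultiples S w) at off
    where
    S = suc s
    at : ∀ e → (monoS (k ℕ.* S) ⊛ onMultiples S w) (e ℕ.* S) ≡ delay k w e
    at e with k ℕ.≤? e
    ... | yes k≤e rewrite dec-true (k ℕ.≤? e) k≤e = begin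
      (monoS (k ℕ.* S) ⊛ onMultiples S w) (e ℕ.* S)
        ≡⟨ monoS-⊛ (k ℕ.* S) (onMultiples S w) (e ℕ.* S) (ℕₚ.*-monoˡ-≤ S k≤e) ⟩
      onMultiples S w (e ℕ.* S ℕ.∸ k ℕ.* S)
        ≡⟨ cong (onMultiples S w) (sym (ℕₚ.*-distribʳ-∸ S e k)) ⟩
      onMultiples S w ((e ℕ.∸ k) ℕ.* S)
        ≡⟨ onMultiples-at s w (e ℕ.∸ k) ⟩
      w (e ℕ.∸ k) ∎
    ... | no k≰e rewrite dec-false (k ℕ.≤? e) k≰e =
      monoS-⊛-< (k ℕ.* S) (onMultiples S w) (e ℕ.* S) (ℕₚ.*-monoˡ-< S (ℕₚ.≰⇒> k≰e))
    off : ∀ n → ¬ S ∣ n → (monoS (k ℕ.* S) ⊛ onMultiples S w) n ≡ + 0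
    off n S∤n with k ℕ.* S ℕ.≤? n
    ... | yes kS≤n = trans (monoS-⊛ (k ℕ.* S) (onMultiples S w) n kS≤n) (onMultiples-off S w _
                       (λ S∣n∸kS → S∤n (∣m∸n∣n⇒∣m S kS≤n S∣n∸kS (n∣m*n k))))
    ... | no kS≰n = monoS-⊛-< (k ℕ.* S) (onMultiples S w) n (ℕₚ.≰⇒> kS≰n)

  oneS-onMultiples : ∀ s → oneS ≗ onMultiples (suc s) (δ 0)
  oneS-onMultiples s = ≗-onMultiples s (δ 0) oneS at off
    where
    at : ∀ e → oneS (e ℕ.* suc s) ≡ δ 0 e
    at zero    = refl
    at (suc e) = refl
    off : ∀ n → ¬ suc s ∣ n → oneS n ≡ + 0
    off zero    S∤0 = contradiction (suc s ∣0) S∤0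
    off (suc n) _   = refl

  onePlus-⊛-onMultiples : ∀ s w →
    (oneS ⊕ monoS (suc s)) ⊛ onMultiples (suc s) w ≗ onMultiples (suc s) (λ e → w e + delay 1 w e)
  onePlus-⊛-onMultiples s w n = begin
    ((oneS ⊕ monoS S) ⊛ W) n         ≡⟨ ⊛-distribʳ-⊕ oneS (monoS S) W n ⟩
    (oneS ⊛ W) n + (monoS S ⊛ W) n   ≡⟨ cong₂ _+_ (⊛-identityˡ W n) (⊛-congʳ W monoS-S n) ⟩
    W n + (monoS (1 ℕ.* S) ⊛ W) n    ≡⟨ cong (_+_ (W n)) (monoS-⊛-onMultiples s 1 w n) ⟩
    W n + onMultiples S (delay 1 w) n ≡⟨ onMultiples-+ S w (delay 1 w) n ⟩
    onMultiples S (λ e → w e + delay 1 w e) n ∎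
    where
    S = suc s
    W = onMultiples S w
    monoS-S : monoS S ≗ monoS (1 ℕ.* S)
    monoS-S n = cong (λ e → monoS e n) (sym (ℕₚ.*-identityˡ S))

  onePlus-⊛-recip : ∀ s → (oneS ⊕ monoS (suc s)) ⊛ geomS -1ℤ (suc s) ≗ oneS
  onePlus-⊛-recip s n = begin
    ((oneS ⊕ monoS (suc s)) ⊛ geomS -1ℤ (suc s)) n
      ≡⟨ onePlus-⊛-onMultiples s (-1ℤ ^_) n ⟩
    onMultiples (suc s) (λ e → -1ℤ ^ e + delay 1 (-1ℤ ^_) e) n
      ≡⟨ onMultiples-cong (suc s) weights n ⟩
    onMultiples (suc s) (δ 0) n
      ≡⟨ sym (oneS-onMultiples s n) ⟩
    oneS n ∎
    where
    weights : ∀ e → -1ℤ ^ e + delay 1 (-1ℤ ^_) e ≡ δ 0 e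
    weights zero    = refl
    weights (suc e) = cancel (-1ℤ ^ e)
      where
      cancel : ∀ x → -1ℤ * x + x ≡ + 0
      cancel = solve-∀

  unrestricted : ℕ → ℤ
  unrestricted zero    = + 1
  unrestricted (suc _) = + 2

  onePlus-⊛-geom : ∀ s → (oneS ⊕ monoS (suc s)) ⊛ geomS (+ 1) (suc s) ≗ onMultiples (suc s) unrestricted
  onePlus-⊛-geom s n = trans (onePlus-⊛-onMultiples s (1ℤ ^_) n) (onMultiples-cong (suc s) weights n)
    where
    weights : ∀ e → 1ℤ ^ e + delay 1 (1ℤ ^_) e ≡ unrestricted e
    weights zero    = refl
    weights (suc e) = cong₂ _+_ (ℤₚ.^-zeroˡ (suc e)) (ℤₚ.^-zeroˡ e)

  restricted : ℕ → ℕ → ℤ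
  restricted r = delay r (λ _ → + 1)

  monoS-⊛-geom : ∀ s r → monoS (r ℕ.* suc s) ⊛ geomS (+ 1) (suc s) ≗ onMultiples (suc s) (restricted r)
  monoS-⊛-geom s r n = trans (monoS-⊛-onMultiples s r (1ℤ ^_) n) (onMultiples-cong (suc s) weights n)
    where
    weights : ∀ e → delay r (1ℤ ^_) e ≡ restricted r e
    weights e with r ≤ᵇ e
    ... | true  = ℤₚ.^-zeroˡ (e ℕ.∸ r)
    ... | false = refl

  onMultiples-≗[] : ∀ s w → w 0 ≡ + 1 → onMultiples (suc s) w ≗[ s ] oneS
  onMultiples-≗[] s w w0≡1 zero    _      = trans (onMultiples-at s w 0) w0≡1
  onMultiples-≗[] s w w0≡1 (suc j) 1+j≤s = onMultiples-off (suc s) w (suc j)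
    (λ S∣1+j → ℕₚ.<-irrefl refl (ℕₚ.≤-trans (∣⇒≤ S∣1+j) 1+j≤s))

  onMultiples-⊛ : ∀ s w X n → (onMultiples (suc s) w ⊛ X) n
    ≡ sumTo n (λ e → if suc s ℕ.* e ≤ᵇ n then w e * X (n ℕ.∸ suc s ℕ.* e) else + 0)
  onMultiples-⊛ s w X n = begin
    sumTo n (λ i → sumTo i (λ e → δ (S ℕ.* e) i * w e) * X (n ℕ.∸ i))
      ≡⟨ sumTo-cong n (λ i _ → *-distribʳ-sumTo i (X (n ℕ.∸ i)) _) ⟩
    sumTo n (λ i → sumTo i (λ e → δ (S ℕ.* e) i * w e * X (n ℕ.∸ i)))
      ≡⟨ sumTo-triangle n (λ i e → δ (S ℕ.* e) i * w e * X (n ℕ.∸ i)) ⟩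
    sumTo n (λ e → sumTo (n ℕ.∸ e) (λ l → δ (S ℕ.* e) (e ℕ.+ l) * w e * X (n ℕ.∸ (e ℕ.+ l))))
      ≡⟨ sumTo-cong n column ⟩
    sumTo n (λ e → if S ℕ.* e ≤ᵇ n then w e * X (n ℕ.∸ S ℕ.* e) else + 0) ∎
    where
    S = suc s
    -- The only possibly nonzero term of column e is l = S e ∸ e, where e + l = S e.
    column : ∀ e → e ≤ n → sumTo (n ℕ.∸ e) (λ l → δ (S ℕ.* e) (e ℕ.+ l) * w e * X (n ℕ.∸ (e ℕ.+ l)))
                 ≡ (if S ℕ.* e ≤ᵇ n then w e * X (n ℕ.∸ S ℕ.* e) else + 0)
    column e e≤n with S ℕ.* e ℕ.≤? n
    ... | yes Se≤n rewrite dec-true (S ℕ.* e ℕ.≤? n) Se≤n = begin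
      sumTo (n ℕ.∸ e) (λ l → δ (S ℕ.* e) (e ℕ.+ l) * w e * X (n ℕ.∸ (e ℕ.+ l)))
        ≡⟨ sumTo-single (n ℕ.∸ e) (S ℕ.* e ℕ.∸ e) (ℕₚ.∸-monoˡ-≤ e Se≤n) (λ l _ l≢ →
             trans (cong (λ d → d * w e * X (n ℕ.∸ (e ℕ.+ l)))
                         (δ-≢ _ _ (λ Se≡e+l → l≢ (trans (sym (ℕₚ.m+n∸m≡n e l)) (cong (ℕ._∸ e) (sym Se≡e+l))))))
                   (cong (_* X (n ℕ.∸ (e ℕ.+ l))) (ℤₚ.*-zeroˡ (w e)))) ⟩
      δ (S ℕ.* e) (e ℕ.+ (S ℕ.* e ℕ.∸ e)) * w e * X (n ℕ.∸ (e ℕ.+ (S ℕ.* e ℕ.∸ e)))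
        ≡⟨ cong (λ i → δ (S ℕ.* e) i * w e * X (n ℕ.∸ i)) (ℕₚ.m+[n∸m]≡n (ℕₚ.m≤n*m e S)) ⟩
      δ (S ℕ.* e) (S ℕ.* e) * w e * X (n ℕ.∸ S ℕ.* e)
        ≡⟨ cong (λ d → d * w e * X (n ℕ.∸ S ℕ.* e)) (δ-refl (S ℕ.* e)) ⟩
      + 1 * w e * X (n ℕ.∸ S ℕ.* e)
        ≡⟨ cong (_* X (n ℕ.∸ S ℕ.* e)) (ℤₚ.*-identityˡ (w e)) ⟩
      w e * X (n ℕ.∸ S ℕ.* e) ∎
    ... | no Se≰n rewrite dec-false (S ℕ.* e ℕ.≤? n) Se≰n = sumTo-zero (n ℕ.∸ e) (λ l l≤n∸e →
      trans (cong (λ d → d * w e * X (n ℕ.∸ (e ℕ.+ l)))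
                  (δ-≢ _ _ (λ Se≡e+l → Se≰n (subst (_≤ n) (sym Se≡e+l) (beyond l l≤n∸e)))))
            (cong (_* X (n ℕ.∸ (e ℕ.+ l))) (ℤₚ.*-zeroˡ (w e))))
      where
      beyond : ∀ l → l ≤ n ℕ.∸ e → e ℕ.+ l ≤ n
      beyond l l≤n∸e = ℕₚ.≤-trans (ℕₚ.+-monoʳ-≤ e l≤n∸e) (ℕₚ.≤-reflexive (ℕₚ.m+[n∸m]≡n e≤n))

open SeriesOnMultiples

module TruncatedProducts where

  open import Data.Nat as ℕ using (ℕ; zero; suc; _≤_; _<_; s≤s)
  import Data.Nat.Properties as ℕₚ
  open import Data.Integer using (ℤ; +_; _+_; 1ℤ)
  import Data.Integer.Properties as ℤₚ
  open import Relation.Nullary using (yes; no)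
  open import Relation.Binary.Reasoning.Setoid (ℕ →-setoid ℤ)

  ≗-refl : ∀ {f : Series} → f ≗ f
  ≗-refl _ = refl

  prodFrom1-cong : ∀ F G N → (∀ t → suc t ≤ N → F (suc t) ≗ G (suc t)) →
    prodFrom1 F N ≗ prodFrom1 G N
  prodFrom1-cong F G zero    F≗G = ≗-refl
  prodFrom1-cong F G (suc N) F≗G =
    ⊛-cong (prodFrom1-cong F G N (λ t t<N → F≗G t (ℕₚ.m≤n⇒m≤1+n t<N))) (F≗G N ℕₚ.≤-refl)

  prodFrom1-oneS : ∀ N → prodFrom1 (λ _ → oneS) N ≗ oneS
  prodFrom1-oneS zero    = ≗-refl {oneS}
  prodFrom1-oneS (suc N) n = trans (⊛-identityʳ (prodFrom1 (λ _ → oneS) N) n) (prodFrom1-oneS N n)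

  prodFrom1-⊛ : ∀ F X Y N → (∀ t → suc t ≤ N → F (suc t) ≗ X (suc t) ⊛ Y (suc t)) →
    prodFrom1 F N ≗ prodFrom1 X N ⊛ prodFrom1 Y N
  prodFrom1-⊛ F X Y zero    _   n = sym (⊛-identityˡ oneS n)
  prodFrom1-⊛ F X Y (suc N) F≗XY = begin
    prodFrom1 F N ⊛ F (suc N)
      ≈⟨ ⊛-cong (prodFrom1-⊛ F X Y N (λ t t<N → F≗XY t (ℕₚ.m≤n⇒m≤1+n t<N))) (F≗XY N ℕₚ.≤-refl) ⟩
    (prodFrom1 X N ⊛ prodFrom1 Y N) ⊛ (X (suc N) ⊛ Y (suc N))
      ≈⟨ interchange (prodFrom1 X N) (prodFrom1 Y N) (X (suc N)) (Y (suc N)) ⟩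
    prodFrom1 X (suc N) ⊛ prodFrom1 Y (suc N) ∎

  prodFrom1-update : ∀ F G u N → suc u ≤ N → (∀ t → suc t ≤ N → t ≢ u → G (suc t) ≗ F (suc t)) →
    F (suc u) ≗ oneS → prodFrom1 G N ≗ prodFrom1 F N ⊛ G (suc u)
  prodFrom1-update F G u (suc N) u<1+N G≗F Fu≗1 with N ℕ.≟ u
  ... | yes refl = begin
    prodFrom1 G N ⊛ G (suc N)           ≈⟨ ⊛-congʳ (G (suc N)) (prodFrom1-cong G F N G≗F-below) ⟩
    prodFrom1 F N ⊛ G (suc N)           ≈⟨ ⊛-congʳ (G (suc N)) (⊛-identityʳ (prodFrom1 F N)) ⟨
    (prodFrom1 F N ⊛ oneS) ⊛ G (suc N)  ≈⟨ ⊛-congʳ (G (suc N)) (⊛-congˡ (prodFrom1 F N) Fu≗1) ⟨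
    prodFrom1 F (suc N) ⊛ G (suc N)     ∎
    where
    G≗F-below : ∀ t → suc t ≤ N → G (suc t) ≗ F (suc t)
    G≗F-below t t<N = G≗F t (ℕₚ.m≤n⇒m≤1+n t<N) λ { refl → ℕₚ.<-irrefl refl t<N }
  ... | no N≢u = begin
    prodFrom1 G N ⊛ G (suc N)
      ≈⟨ ⊛-cong (prodFrom1-update F G u N u<N (λ t t<N → G≗F t (ℕₚ.m≤n⇒m≤1+n t<N)) Fu≗1)
                (G≗F N ℕₚ.≤-refl N≢u) ⟩
    (prodFrom1 F N ⊛ G (suc u)) ⊛ F (suc N)
      ≈⟨ xy∙z≈xz∙y (prodFrom1 F N) (G (suc u)) (F (suc N)) ⟩
    prodFrom1 F (suc N) ⊛ G (suc u) ∎
    where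
    u<N : suc u ≤ N
    u<N = ℕₚ.≤-pred (ℕₚ.≤∧≢⇒< u<1+N (λ 1+u≡1+N → N≢u (sym (ℕₚ.suc-injective 1+u≡1+N))))

  module Stable (F : ℕ → Series) (F≡1 : ∀ t → F (suc t) ≗[ t ] oneS) where

    prodFrom1-suc-≗[] : ∀ N → prodFrom1 F (suc N) ≗[ N ] prodFrom1 F N
    prodFrom1-suc-≗[] N i i≤N =
      trans (⊛-cong-≤ {f = prodFrom1 F N} N (λ _ _ → refl) (F≡1 N) i i≤N) (⊛-identityʳ (prodFrom1 F N) i)

    prodFrom1-+-stable : ∀ i d → prodFrom1 F (i ℕ.+ d) i ≡ prodFrom1 F i i
    prodFrom1-+-stable i zero    rewrite ℕₚ.+-identityʳ i = refl
    prodFrom1-+-stable i (suc d) rewrite ℕₚ.+-suc i d =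
      trans (prodFrom1-suc-≗[] (i ℕ.+ d) i (ℕₚ.m≤m+n i d)) (prodFrom1-+-stable i d)

    prodFrom1-≗[]-infProd : ∀ N → prodFrom1 F N ≗[ N ] infProd F
    prodFrom1-≗[]-infProd N i i≤N =
      subst (λ M → prodFrom1 F M i ≡ infProd F i) (ℕₚ.m+[n∸m]≡n i≤N) (prodFrom1-+-stable i (N ℕ.∸ i))

  onePlus-≗[] : ∀ t → oneS ⊕ monoS (suc t) ≗[ t ] oneS
  onePlus-≗[] t j j≤t = trans (cong (_+_ (oneS j)) (δ-≢ (suc t) j (λ { refl → ℕₚ.<-irrefl refl (s≤s j≤t) })))
                              (ℤₚ.+-identityʳ (oneS j))

  prodFrom1-≗[]-minusQInf⊛invQInf : ∀ N →
    prodFrom1 (λ t → (oneS ⊕ monoS t) ⊛ geomS 1ℤ t) N ≗[ N ] minusQInf ⊛ invQInf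
  prodFrom1-≗[]-minusQInf⊛invQInf N i i≤N =
    trans (prodFrom1-⊛ _ (λ t → oneS ⊕ monoS t) (geomS 1ℤ) N (λ _ _ _ → refl) i)
          (⊛-cong-≤ N (Stable.prodFrom1-≗[]-infProd (λ t → oneS ⊕ monoS t) onePlus-≗[] N)
                      (Stable.prodFrom1-≗[]-infProd (geomS 1ℤ) (λ s → onMultiples-≗[] s _ refl) N) i i≤N)

open TruncatedProducts

module ProductFormula (r : ℕ) where

  open import Data.Nat as ℕ using (ℕ; suc)
  open import Data.Integer using (ℤ; 1ℤ; -1ℤ)
  open import Data.Bool using (Bool; true; false; if_then_else_)
  open import Relation.Binary.Reasoning.Setoid (ℕ →-setoid ℤ)

  -- The generating function of the multiplicities of one part size t: parts of size t are
  -- unrestricted, or (if selected) must make t fail to qualify for mes.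
  weight : Bool → ℕ → ℤ
  weight true  = restricted r
  weight false = unrestricted

  factor : (ℕ → Bool) → ℕ → Series
  factor S t = onMultiples t (weight (S t))

  -- The factor q^{rt} / (1 + q^t) that Dterm gains for t = a + jA.
  dFactor : ℕ → Series
  dFactor t = monoS (r ℕ.* t) ⊛ geomS -1ℤ t

  selected : (ℕ → Bool) → ℕ → Series
  selected S t = if S t then dFactor t else oneS

  onePlus⊛geom : ℕ → Series
  onePlus⊛geom t = (oneS ⊕ monoS t) ⊛ geomS 1ℤ t

  restricted-factorisation : ∀ s → onMultiples (suc s) (restricted r) ≗ onePlus⊛geom (suc s) ⊛ dFactor (suc s)
  restricted-factorisation s = begin
    onMultiples S (restricted r)    ≈⟨ monoS-⊛-geom s r ⟨
    M ⊛ G                           ≈⟨ ⊛-comm M G ⟩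
    G ⊛ M                           ≈⟨ ⊛-identityˡ (G ⊛ M) ⟨
    oneS ⊛ (G ⊛ M)                  ≈⟨ ⊛-congʳ (G ⊛ M) (onePlus-⊛-recip s) ⟨
    (P ⊛ G⁻) ⊛ (G ⊛ M)              ≈⟨ interchange P G⁻ G M ⟩
    (P ⊛ G) ⊛ (G⁻ ⊛ M)              ≈⟨ ⊛-congˡ (P ⊛ G) (⊛-comm G⁻ M) ⟩
    (P ⊛ G) ⊛ (M ⊛ G⁻)              ∎
    where
    S = suc s
    P = oneS ⊕ monoS S
    G = geomS 1ℤ S
    G⁻ = geomS -1ℤ S
    M = monoS (r ℕ.* S)

  factor-factorisation : ∀ S s → factor S (suc s) ≗ onePlus⊛geom (suc s) ⊛ selected S (suc s)
  factor-factorisation S s with S (suc s)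
  ... | true  = restricted-factorisation s
  ... | false = λ n → trans (sym (onePlus-⊛-geom s n)) (sym (⊛-identityʳ (onePlus⊛geom (suc s)) n))

  prodFrom1-factor : ∀ S N → prodFrom1 (factor S) N ≗ prodFrom1 onePlus⊛geom N ⊛ prodFrom1 (selected S) N
  prodFrom1-factor S N = prodFrom1-⊛ (factor S) onePlus⊛geom (selected S) N (λ s _ → factor-factorisation S s)

module Progression (A′ a′ r : ℕ) where

  open import Data.Nat as ℕ using (zero; suc; _≤_; _<_; _≡ᵇ_)
  import Data.Nat.Properties as ℕₚ
  open import Data.Nat.Combinatorics using (_C_; nC1≡n; nCk+nC[k+1]≡[n+1]C[k+1])
  open import Data.Nat.Tactic.RingSolver using (solve-∀)
  open import Data.Integer using (ℤ; -1ℤ)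
  open import Data.Bool using (Bool; true; false; _∨_)
  open import Data.Bool.Properties using (∨-identityʳ; ∨-zeroʳ)
  open import Relation.Nullary.Decidable using (dec-true; dec-false)
  open import Relation.Binary.Reasoning.Setoid (ℕ →-setoid ℤ)
  open ProductFormula r

  A a : ℕ
  A = suc A′
  a = suc a′

  prog : ℕ → ℕ
  prog j = a ℕ.+ j ℕ.* A

  inProg : ℕ → ℕ → Bool
  inProg zero    t = false
  inProg (suc k) t = inProg k t ∨ (t ≡ᵇ prog k)

  prog-injective : ∀ i j → prog i ≡ prog j → i ≡ j
  prog-injective i j eq = ℕₚ.*-cancelʳ-≡ i j A (ℕₚ.+-cancelˡ-≡ a (i ℕ.* A) (j ℕ.* A) eq)

  inProg-prog : ∀ k i → k ≤ i → inProg k (prog i) ≡ false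
  inProg-prog zero    i _   = refl
  inProg-prog (suc k) i k<i rewrite inProg-prog k i (ℕₚ.<⇒≤ k<i) =
    dec-false (prog i ℕ.≟ prog k) (λ eq → ℕₚ.<⇒≢ k<i (sym (prog-injective i k eq)))

  inProg-suc-prog : ∀ k → inProg (suc k) (prog k) ≡ true
  inProg-suc-prog k rewrite dec-true (prog k ℕ.≟ prog k) refl = ∨-zeroʳ (inProg k (prog k))

  dExponent : ℕ → ℕ
  dExponent k = r ℕ.* (A ℕ.* (k C 2) ℕ.+ k ℕ.* a)

  dExponent-suc : ∀ k → dExponent (suc k) ≡ dExponent k ℕ.+ r ℕ.* prog k
  dExponent-suc k rewrite sym (nCk+nC[k+1]≡[n+1]C[k+1] k 1) | nC1≡n k = expand r A (k C 2) k a
    where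
    expand : ∀ r A c k a → r ℕ.* (A ℕ.* (k ℕ.+ c) ℕ.+ suc k ℕ.* a)
                         ≡ r ℕ.* (A ℕ.* c ℕ.+ k ℕ.* a) ℕ.+ r ℕ.* (a ℕ.+ k ℕ.* A)
    expand = solve-∀

  Dterm-zero : Dterm r A a 0 ≗ oneS
  Dterm-zero n = trans (cong (λ e → (monoS e ⊛ oneS) n) exponent-zero) (⊛-identityˡ oneS n)
    where
    exponent-zero : dExponent 0 ≡ 0
    exponent-zero rewrite ℕₚ.*-zeroʳ A = ℕₚ.*-zeroʳ r

  Dterm-suc : ∀ k → Dterm r A a (suc k) ≗ Dterm r A a k ⊛ dFactor (prog k)
  Dterm-suc k = begin
    monoS (dExponent (suc k)) ⊛ (invPoch A a k ⊛ G⁻)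
      ≈⟨ ⊛-congʳ (invPoch A a (suc k)) (λ n → cong (λ e → monoS e n) (dExponent-suc k)) ⟩
    monoS (dExponent k ℕ.+ r ℕ.* prog k) ⊛ (invPoch A a k ⊛ G⁻)
      ≈⟨ ⊛-congʳ (invPoch A a (suc k)) (monoS-+ (dExponent k) (r ℕ.* prog k)) ⟩
    (monoS (dExponent k) ⊛ monoS (r ℕ.* prog k)) ⊛ (invPoch A a k ⊛ G⁻)
      ≈⟨ interchange (monoS (dExponent k)) (monoS (r ℕ.* prog k)) (invPoch A a k) G⁻ ⟩
    Dterm r A a k ⊛ dFactor (prog k) ∎
    where
    G⁻ = geomS -1ℤ (prog k)

  prodFrom1-selected : ∀ k N → (∀ j → j < k → prog j ≤ N) →
    prodFrom1 (selected (inProg k)) N ≗ Dterm r A a k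
  prodFrom1-selected zero    N _ = begin
    prodFrom1 (λ _ → oneS) N ≈⟨ prodFrom1-oneS N ⟩
    oneS                     ≈⟨ Dterm-zero ⟨
    Dterm r A a 0            ∎
  prodFrom1-selected (suc k) N prog<N = begin
    prodFrom1 (selected (inProg (suc k))) N
      ≈⟨ prodFrom1-update (selected (inProg k)) (selected (inProg (suc k))) u N
           (prog<N k ℕₚ.≤-refl) unchanged dropped ⟩
    prodFrom1 (selected (inProg k)) N ⊛ selected (inProg (suc k)) (prog k)
      ≈⟨ ⊛-congˡ (prodFrom1 (selected (inProg k)) N) added ⟩
    prodFrom1 (selected (inProg k)) N ⊛ dFactor (prog k)
      ≈⟨ ⊛-congʳ (dFactor (prog k)) (prodFrom1-selected k N (λ j j<k → prog<N j (ℕₚ.m≤n⇒m≤1+n j<k))) ⟩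
    Dterm r A a k ⊛ dFactor (prog k)
      ≈⟨ Dterm-suc k ⟨
    Dterm r A a (suc k) ∎
    where
    u = a′ ℕ.+ k ℕ.* A
    unchanged : ∀ t → suc t ≤ N → t ≢ u → selected (inProg (suc k)) (suc t) ≗ selected (inProg k) (suc t)
    unchanged t _ t≢u rewrite dec-false (t ℕ.≟ u) t≢u | ∨-identityʳ (inProg k (suc t)) = λ _ → refl
    dropped : selected (inProg k) (prog k) ≗ oneS
    dropped rewrite inProg-prog k k ℕₚ.≤-refl = λ _ → refl
    added : selected (inProg (suc k)) (prog k) ≗ dFactor (prog k)
    added rewrite inProg-suc-prog k = λ _ → refl

  prodFrom1-factor-≗[] : ∀ k N → (∀ j → j < k → prog j ≤ N) →
    prodFrom1 (factor (inProg k)) N ≗[ N ] (minusQInf ⊛ invQInf) ⊛ Dterm r A a k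
  prodFrom1-factor-≗[] k N prog<N i i≤N = trans (prodFrom1-factor (inProg k) N i)
    (⊛-cong-≤ N (prodFrom1-≗[]-minusQInf⊛invQInf N) (λ j _ → prodFrom1-selected k N prog<N j) i i≤N)

module ListCounting where

  open import Data.Nat using (ℕ; suc; _+_; _*_)
  import Data.Nat.Properties as ℕₚ
  open import Data.Nat.Tactic.RingSolver using (solve-∀)
  open import Data.Bool using (Bool; true; false; _∧_)
  open import Data.List using (List; []; _∷_; _++_; map; filter; length)
  open import Data.List.Membership.Propositional using (_∈_)
  open import Data.List.Membership.Propositional.Properties.WithK using (unique∧set⇒bag)
  open import Data.List.Relation.Unary.Any using (here; there)
  open import Data.List.Relation.Unary.Unique.Propositional using (Unique)
  open import Data.List.Relation.Binary.Permutation.Propositional as ↭ using (_↭_)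
  open import Data.List.Relation.Binary.BagAndSetEquality using (∼bag⇒↭)
  open import Function using (_∘_; mk⇔)
  open import Relation.Nullary using (does)
  open import Relation.Unary using (Decidable)
  open ≡-Reasoning

  private variable
    A B : Set

  toℕ : Bool → ℕ
  toℕ true  = 1
  toℕ false = 0

  count : (A → Bool) → List A → ℕ
  count p []       = 0
  count p (x ∷ xs) = toℕ (p x) + count p xs

  count-++ : ∀ (p : A → Bool) xs ys → count p (xs ++ ys) ≡ count p xs + count p ys
  count-++ p []       ys = refl
  count-++ p (x ∷ xs) ys = trans (cong (toℕ (p x) +_) (count-++ p xs ys)) (sym (ℕₚ.+-assoc (toℕ (p x)) _ _))

  count-map : ∀ (p : B → Bool) (f : A → B) xs → count p (map f xs) ≡ count (p ∘ f) xs
  count-map p f []       = refl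
  count-map p f (x ∷ xs) = cong (toℕ (p (f x)) +_) (count-map p f xs)

  count-cong : ∀ {p q : A → Bool} xs → (∀ x → x ∈ xs → p x ≡ q x) → count p xs ≡ count q xs
  count-cong []       _   = refl
  count-cong (x ∷ xs) p≡q =
    cong₂ _+_ (cong toℕ (p≡q x (here refl))) (count-cong xs (λ y y∈xs → p≡q y (there y∈xs)))

  count-≡0 : ∀ {p : A → Bool} xs → (∀ x → x ∈ xs → p x ≡ false) → count p xs ≡ 0
  count-≡0 []       _    = refl
  count-≡0 (x ∷ xs) p≡ff rewrite p≡ff x (here refl) = count-≡0 xs (λ y y∈xs → p≡ff y (there y∈xs))

  count-∧ʳ : ∀ (p : A → Bool) c xs → count (λ x → p x ∧ c) xs ≡ count p xs * toℕ c
  count-∧ʳ p c []       = refl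
  count-∧ʳ p c (x ∷ xs) = begin
    toℕ (p x ∧ c) + count (λ x → p x ∧ c) xs ≡⟨ cong₂ _+_ (toℕ-∧ (p x) c) (count-∧ʳ p c xs) ⟩
    toℕ (p x) * toℕ c + count p xs * toℕ c   ≡⟨ ℕₚ.*-distribʳ-+ (toℕ c) (toℕ (p x)) (count p xs) ⟨
    (toℕ (p x) + count p xs) * toℕ c         ∎
    where
    toℕ-∧ : ∀ b c → toℕ (b ∧ c) ≡ toℕ b * toℕ c
    toℕ-∧ true  true  = refl
    toℕ-∧ true  false = refl
    toℕ-∧ false _     = refl

  count-+ : ∀ (p q s : A → Bool) xs → (∀ x → toℕ (p x) + toℕ (q x) ≡ toℕ (s x)) →
    count p xs + count q xs ≡ count s xs
  count-+ p q s []       _ = refl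
  count-+ p q s (x ∷ xs) pq≡s =
    trans (+-interchange (toℕ (p x)) (count p xs) (toℕ (q x)) (count q xs))
          (cong₂ _+_ (pq≡s x) (count-+ p q s xs pq≡s))
    where
    +-interchange : ∀ a b c d → (a + b) + (c + d) ≡ (a + c) + (b + d)
    +-interchange = solve-∀

  length-filter : ∀ {P : A → Set} (P? : Decidable P) xs → length (filter P? xs) ≡ count (does ∘ P?) xs
  length-filter P? []       = refl
  length-filter P? (x ∷ xs) with does (P? x)
  ... | true  = cong suc (length-filter P? xs)
  ... | false = length-filter P? xs

  count-↭ : ∀ (p : A → Bool) {xs ys} → xs ↭ ys → count p xs ≡ count p ys
  count-↭ p ↭.refl            = refl
  count-↭ p (↭.prep x xs↭ys)  = cong (toℕ (p x) +_) (count-↭ p xs↭ys)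
  count-↭ p (↭.swap {xs} {ys} x y xs↭ys) = begin
    toℕ (p x) + (toℕ (p y) + count p xs) ≡⟨ ℕₚ.+-assoc (toℕ (p x)) _ _ ⟨
    toℕ (p x) + toℕ (p y) + count p xs   ≡⟨ cong₂ _+_ (ℕₚ.+-comm (toℕ (p x)) _) (count-↭ p xs↭ys) ⟩
    toℕ (p y) + toℕ (p x) + count p ys   ≡⟨ ℕₚ.+-assoc (toℕ (p y)) _ _ ⟩
    toℕ (p y) + (toℕ (p x) + count p ys) ∎
  count-↭ p (↭.trans xs↭zs zs↭ys) = trans (count-↭ p xs↭zs) (count-↭ p zs↭ys)

  -- Duplicate-free lists with the same members are permutations of each other.
  count-unique : ∀ (p : A → Bool) {xs ys} → Unique xs → Unique ys →
    (∀ x → x ∈ xs → x ∈ ys) → (∀ x → x ∈ ys → x ∈ xs) → count p xs ≡ count p ys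
  count-unique p !xs !ys xs⊆ys ys⊆xs =
    count-↭ p (∼bag⇒↭ (unique∧set⇒bag !xs !ys (mk⇔ (xs⊆ys _) (ys⊆xs _))))

open ListCounting

module OverpartitionStructure where

  open import Data.Nat as ℕ using (ℕ; zero; suc; _+_; _*_; _≤_; _<_; _≡ᵇ_; z≤n; s≤s)
  import Data.Nat.Properties as ℕₚ
  open import Data.Nat.ListAction using (sum)
  open import Data.Nat.ListAction.Properties using (sum-++)
  open import Data.Bool using (Bool; true; false; _∧_)
  open import Data.Unit using (⊤; tt)
  open import Data.Sum using (_⊎_; inj₁; inj₂)
  open import Data.Product using (Σ-syntax; _×_; _,_; proj₁)
  open import Data.List using (List; []; _∷_; _++_; map; replicate)
  open import Data.List.Properties using (map-++)
  open import Relation.Nullary using (yes; no)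
  open import Relation.Nullary.Decidable using (dec-true; dec-false)

  -- Since the parts of an overpartition are non-increasing, this bounds all of its parts.
  FirstAtMost : ℕ → RawOP → Set
  FirstAtMost N []            = ⊤
  FirstAtMost N ((s , _) ∷ _) = s ≤ N

  CanFollow : ℕ → RawOP → Set
  CanFollow s []              = ⊤
  CanFollow s ((s′ , b′) ∷ _) = s′ < s ⊎ (s′ ≡ s × b′ ≡ false)

  IsOverpartition-∷⁻ : ∀ {s b} ρ → IsOverpartition ((s , b) ∷ ρ) → 1 ≤ s × CanFollow s ρ × IsOverpartition ρ
  IsOverpartition-∷⁻ []      1≤s           = 1≤s , tt , tt
  IsOverpartition-∷⁻ (_ ∷ _) (1≤s , f , v) = 1≤s , f , v

  IsOverpartition-∷⁺ : ∀ {s b} ρ → 1 ≤ s → CanFollow s ρ → IsOverpartition ρ → IsOverpartition ((s , b) ∷ ρ)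
  IsOverpartition-∷⁺ []      1≤s _ _ = 1≤s
  IsOverpartition-∷⁺ (_ ∷ _) 1≤s f v = 1≤s , f , v

  CanFollow⇒FirstAtMost : ∀ {s} ρ → CanFollow s ρ → FirstAtMost s ρ
  CanFollow⇒FirstAtMost []      _                   = tt
  CanFollow⇒FirstAtMost (_ ∷ _) (inj₁ s′<s)         = ℕₚ.<⇒≤ s′<s
  CanFollow⇒FirstAtMost (_ ∷ _) (inj₂ (refl , _))   = ℕₚ.≤-refl

  FirstAtMost⇒CanFollow : ∀ {N} ρ → FirstAtMost N ρ → CanFollow (suc N) ρ
  FirstAtMost⇒CanFollow []      _   = tt
  FirstAtMost⇒CanFollow (_ ∷ _) s≤N = inj₁ (s≤s s≤N)

  FirstAtMost-mono : ∀ {M N} ρ → M ≤ N → FirstAtMost M ρ → FirstAtMost N ρ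
  FirstAtMost-mono []      _   _   = tt
  FirstAtMost-mono (_ ∷ _) M≤N s≤M = ℕₚ.≤-trans s≤M M≤N

  FirstAtMost-size : ∀ π → FirstAtMost (size π) π
  FirstAtMost-size []            = tt
  FirstAtMost-size ((s , _) ∷ ρ) = ℕₚ.m≤m+n s (size ρ)

  -- All parts of size s of an overpartition: optionally an overlined one, then c plain ones.
  copies : ℕ → ℕ → RawOP
  copies s c = replicate c (s , false)

  block : ℕ → Bool → ℕ → RawOP
  block s true  c = (s , true) ∷ copies s c
  block s false c = copies s c

  copies-++-valid : ∀ N c π → IsOverpartition π → FirstAtMost N π →
    IsOverpartition (copies (suc N) c ++ π) × CanFollow (suc N) (copies (suc N) c ++ π)
  copies-++-valid N zero    π v π≤N = v , FirstAtMost⇒CanFollow π π≤N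
  copies-++-valid N (suc c) π v π≤N =
    let v′ , f′ = copies-++-valid N c π v π≤N in
    IsOverpartition-∷⁺ (copies (suc N) c ++ π) (s≤s z≤n) f′ v′ , inj₂ (refl , refl)

  block-++-valid : ∀ N b c π → IsOverpartition π → FirstAtMost N π →
    IsOverpartition (block (suc N) b c ++ π) × FirstAtMost (suc N) (block (suc N) b c ++ π)
  block-++-valid N true  c π v π≤N =
    let v′ , f′ = copies-++-valid N c π v π≤N in
    IsOverpartition-∷⁺ (copies (suc N) c ++ π) (s≤s z≤n) f′ v′ , ℕₚ.≤-refl
  block-++-valid N false c π v π≤N =
    let v′ , f′ = copies-++-valid N c π v π≤N in
    v′ , CanFollow⇒FirstAtMost (copies (suc N) c ++ π) f′

  copies-prefix : ∀ N ρ → IsOverpartition ρ → CanFollow (suc N) ρ →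
    Σ[ c ∈ ℕ ] Σ[ π ∈ RawOP ] ρ ≡ copies (suc N) c ++ π × FirstAtMost N π × IsOverpartition π
  copies-prefix N []              _ _                   = 0 , [] , refl , tt , tt
  copies-prefix N ((s , b) ∷ ρ) v (inj₁ s<1+N)          = 0 , _ , refl , ℕₚ.≤-pred s<1+N , v
  copies-prefix N ((s , b) ∷ ρ) v (inj₂ (refl , refl)) =
    let _ , f , v′ = IsOverpartition-∷⁻ ρ v
        c , π , eq , π≤N , vπ = copies-prefix N ρ v′ f in
    suc c , π , cong (_ ∷_) eq , π≤N , vπ

  block-prefix : ∀ N ρ → IsOverpartition ρ → FirstAtMost (suc N) ρ →
    Σ[ b ∈ Bool ] Σ[ c ∈ ℕ ] Σ[ π ∈ RawOP ] ρ ≡ block (suc N) b c ++ π × FirstAtMost N π × IsOverpartition π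
  block-prefix N []              _ _ = false , 0 , [] , refl , tt , tt
  block-prefix N ((s , b) ∷ ρ) v s≤1+N with s ℕ.≟ suc N
  ... | no s≢1+N = false , 0 , _ , refl , ℕₚ.≤-pred (ℕₚ.≤∧≢⇒< s≤1+N s≢1+N) , v
  block-prefix N ((s , true) ∷ ρ) v _ | yes refl =
    let _ , f , v′ = IsOverpartition-∷⁻ ρ v
        c , π , eq , π≤N , vπ = copies-prefix N ρ v′ f in
    true , c , π , cong (_ ∷_) eq , π≤N , vπ
  block-prefix N ((s , false) ∷ ρ) v _ | yes refl =
    let c , π , eq , π≤N , vπ = copies-prefix N _ v (inj₂ (refl , refl)) in
    false , c , π , eq , π≤N , vπ

  size-++ : ∀ xs ys → size (xs ++ ys) ≡ size xs + size ys
  size-++ xs ys = trans (cong sum (map-++ proj₁ xs ys)) (sum-++ (map proj₁ xs) (map proj₁ ys))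

  size-copies : ∀ s c → size (copies s c) ≡ c * s
  size-copies s zero    = refl
  size-copies s (suc c) = cong (s +_) (size-copies s c)

  size-block : ∀ s b c → size (block s b c) ≡ (toℕ b + c) * s
  size-block s true  c = cong (s +_) (size-copies s c)
  size-block s false c = size-copies s c

  size-block-++ : ∀ s b c π → size (block s b c ++ π) ≡ s * (toℕ b + c) + size π
  size-block-++ s b c π = trans (size-++ (block s b c) π)
    (cong (_+ size π) (trans (size-block s b c) (ℕₚ.*-comm (toℕ b + c) s)))

  cnt-∷-≢ : ∀ s t b b′ π → s ≢ t → cnt t b ((s , b′) ∷ π) ≡ cnt t b π
  cnt-∷-≢ s t b b′ π s≢t rewrite dec-false (s ℕ.≟ t) s≢t = refl

  cnt-++ : ∀ t b xs ys → cnt t b (xs ++ ys) ≡ cnt t b xs + cnt t b ys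
  cnt-++ t b []              ys = refl
  cnt-++ t b ((s , b′) ∷ xs) ys with (s ≡ᵇ t) ∧ sameB b b′
  ... | true  = cong suc (cnt-++ t b xs ys)
  ... | false = cnt-++ t b xs ys

  cnt-copies-≢ : ∀ {s t} b c → s ≢ t → cnt t b (copies s c) ≡ 0
  cnt-copies-≢         b zero    _   = refl
  cnt-copies-≢ {s} {t} b (suc c) s≢t = trans (cnt-∷-≢ s t b false (copies s c) s≢t) (cnt-copies-≢ b c s≢t)

  cnt-copies-true : ∀ s c → cnt s true (copies s c) ≡ 0
  cnt-copies-true s zero    = refl
  cnt-copies-true s (suc c) rewrite dec-true (s ℕ.≟ s) refl = cnt-copies-true s c

  cnt-copies-false : ∀ s c → cnt s false (copies s c) ≡ c
  cnt-copies-false s zero    = refl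
  cnt-copies-false s (suc c) rewrite dec-true (s ℕ.≟ s) refl = cong suc (cnt-copies-false s c)

  cnt-block-≢ : ∀ {s t} b′ b c → s ≢ t → cnt t b′ (block s b c) ≡ 0
  cnt-block-≢ {s} {t} b′ true  c s≢t = trans (cnt-∷-≢ s t b′ true (copies s c) s≢t) (cnt-copies-≢ b′ c s≢t)
  cnt-block-≢         b′ false c s≢t = cnt-copies-≢ b′ c s≢t

  cnt-block-true : ∀ s b c → cnt s true (block s b c) ≡ toℕ b
  cnt-block-true s true  c rewrite dec-true (s ℕ.≟ s) refl = cong suc (cnt-copies-true s c)
  cnt-block-true s false c = cnt-copies-true s c

  cnt-block-false : ∀ s b c → cnt s false (block s b c) ≡ c
  cnt-block-false s true  c rewrite dec-true (s ℕ.≟ s) refl = cnt-copies-false s c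
  cnt-block-false s false c = cnt-copies-false s c

  cnt-beyond-first : ∀ {N t} b π → IsOverpartition π → FirstAtMost N π → N < t → cnt t b π ≡ 0
  cnt-beyond-first         b []             _ _   _   = refl
  cnt-beyond-first {t = t} b ((s , b′) ∷ ρ) v s≤N N<t =
    let _ , f , v′ = IsOverpartition-∷⁻ ρ v in
    trans (cnt-∷-≢ s t b b′ ρ (λ { refl → ℕₚ.<⇒≱ N<t s≤N }))
          (cnt-beyond-first b ρ v′ (FirstAtMost-mono ρ s≤N (CanFollow⇒FirstAtMost ρ f)) N<t)

  cnt-beyond-size : ∀ {t} b π → size π < t → cnt t b π ≡ 0
  cnt-beyond-size     b []             _      = refl
  cnt-beyond-size {t} b ((s , b′) ∷ ρ) size<t =
    trans (cnt-∷-≢ s t b b′ ρ (λ { refl → ℕₚ.<⇒≱ size<t (ℕₚ.m≤m+n s (size ρ)) }))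
          (cnt-beyond-size b ρ (ℕₚ.≤-<-trans (ℕₚ.m≤n+m (size ρ) s) size<t))

  cnt-block-++ : ∀ N b′ b c π → IsOverpartition π → FirstAtMost N π →
    cnt (suc N) b′ (block (suc N) b c ++ π) ≡ cnt (suc N) b′ (block (suc N) b c)
  cnt-block-++ N b′ b c π v π≤N =
    trans (cnt-++ (suc N) b′ (block (suc N) b c) π)
          (trans (cong (cnt (suc N) b′ (block (suc N) b c) +_) (cnt-beyond-first b′ π v π≤N ℕₚ.≤-refl))
                 (ℕₚ.+-identityʳ _))

  cnt-block-++-true : ∀ N b c π → IsOverpartition π → FirstAtMost N π →
    cnt (suc N) true (block (suc N) b c ++ π) ≡ toℕ b
  cnt-block-++-true N b c π v π≤N = trans (cnt-block-++ N true b c π v π≤N) (cnt-block-true (suc N) b c)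

  cnt-block-++-false : ∀ N b c π → IsOverpartition π → FirstAtMost N π →
    cnt (suc N) false (block (suc N) b c ++ π) ≡ c
  cnt-block-++-false N b c π v π≤N = trans (cnt-block-++ N false b c π v π≤N) (cnt-block-false (suc N) b c)

  cnt-block-++-≢ : ∀ {s t} b′ b c π → s ≢ t → cnt t b′ (block s b c ++ π) ≡ cnt t b′ π
  cnt-block-++-≢ {s} {t} b′ b c π s≢t =
    trans (cnt-++ t b′ (block s b c) π) (cong (_+ cnt t b′ π) (cnt-block-≢ b′ b c s≢t))

open OverpartitionStructure

module Enumeration where

  open import Data.Nat as ℕ using (ℕ; zero; suc; _+_; _*_; _≤_; _≤ᵇ_; z≤n)
  import Data.Nat.Properties as ℕₚ
  open import Data.Integer as ℤ using (+_)
  import Data.Integer.Properties as ℤₚ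
  open import Data.Bool using (Bool; true; false; T; if_then_else_)
  open import Data.Unit using (tt)
  open import Data.Empty using (⊥-elim)
  open import Data.Sum using (inj₁; inj₂)
  open import Data.Product using (Σ-syntax; _×_; _,_; proj₁)
  open import Data.List using (List; []; _∷_; _++_; map)
  open import Data.List.Properties using (++-cancelˡ)
  open import Data.List.Membership.Propositional using (_∈_)
  open import Data.List.Membership.Propositional.Properties using (∈-map⁺; ∈-map⁻; ∈-++⁺ˡ; ∈-++⁺ʳ; ∈-++⁻)
  open import Data.List.Relation.Unary.Any using (here)
  open import Data.List.Relation.Unary.All using ([])
  open import Data.List.Relation.Unary.Unique.Propositional using (Unique; []; _∷_)
  import Data.List.Relation.Unary.Unique.Propositional.Properties as Unique
  open import Relation.Nullary using (¬_; yes; no)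
  open import Relation.Nullary.Decidable using (dec-true)
  open ≡-Reasoning

  private variable
    A : Set

  concatTo : ℕ → (ℕ → List A) → List A
  concatTo zero    f = f 0
  concatTo (suc E) f = concatTo E f ++ f (suc E)

  ∈-concatTo⁻ : ∀ E (f : ℕ → List A) {x} → x ∈ concatTo E f → Σ[ e ∈ ℕ ] e ≤ E × x ∈ f e
  ∈-concatTo⁻ zero    f x∈ = 0 , z≤n , x∈
  ∈-concatTo⁻ (suc E) f x∈ with ∈-++⁻ (concatTo E f) x∈
  ... | inj₁ x∈E = let e , e≤E , x∈fe = ∈-concatTo⁻ E f x∈E in e , ℕₚ.m≤n⇒m≤1+n e≤E , x∈fe
  ... | inj₂ x∈f = suc E , ℕₚ.≤-refl , x∈f

  ∈-concatTo⁺ : ∀ E (f : ℕ → List A) {e x} → e ≤ E → x ∈ f e → x ∈ concatTo E f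
  ∈-concatTo⁺ zero    f z≤n x∈ = x∈
  ∈-concatTo⁺ (suc E) f {e} e≤1+E x∈ with e ℕ.≟ suc E
  ... | yes refl = ∈-++⁺ʳ (concatTo E f) x∈
  ... | no e≢1+E = ∈-++⁺ˡ (∈-concatTo⁺ E f (ℕₚ.≤-pred (ℕₚ.≤∧≢⇒< e≤1+E e≢1+E)) x∈)

  concatTo-unique : ∀ E (f : ℕ → List A) (tag : A → ℕ) → (∀ e {x} → x ∈ f e → tag x ≡ e) →
    (∀ e → Unique (f e)) → Unique (concatTo E f)
  concatTo-unique zero    f tag tagged !f = !f 0
  concatTo-unique (suc E) f tag tagged !f =
    Unique.++⁺ (concatTo-unique E f tag tagged !f) (!f (suc E)) λ (x∈E , x∈f) →
      let e , e≤E , x∈fe = ∈-concatTo⁻ E f x∈E in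
      ℕₚ.1+n≰n (subst (_≤ E) (trans (sym (tagged e x∈fe)) (tagged (suc E) x∈f)) e≤E)

  count-concatTo : ∀ E (p : A → Bool) f → + count p (concatTo E f) ≡ sumTo E (λ e → + count p (f e))
  count-concatTo zero    p f = refl
  count-concatTo (suc E) p f = begin
    + count p (concatTo E f ++ f (suc E))
      ≡⟨ cong +_ (count-++ p (concatTo E f) (f (suc E))) ⟩
    + (count p (concatTo E f) + count p (f (suc E)))
      ≡⟨ ℤₚ.pos-+ (count p (concatTo E f)) (count p (f (suc E))) ⟩
    + count p (concatTo E f) ℤ.+ + count p (f (suc E))
      ≡⟨ cong (ℤ._+ + count p (f (suc E))) (count-concatTo E p f) ⟩
    sumTo (suc E) (λ e → + count p (f e)) ∎

  withBlocks : ℕ → List RawOP → ℕ → List RawOP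
  withBlocks s X zero    = X
  withBlocks s X (suc e) = map (block s true e ++_) X ++ map (block s false (suc e) ++_) X

  ∈-withBlocks⁻ : ∀ s X e {π} → π ∈ withBlocks s X e →
    Σ[ b ∈ Bool ] Σ[ c ∈ ℕ ] Σ[ π′ ∈ RawOP ] π ≡ block s b c ++ π′ × toℕ b + c ≡ e × π′ ∈ X
  ∈-withBlocks⁻ s X zero    π∈ = false , 0 , _ , refl , refl , π∈
  ∈-withBlocks⁻ s X (suc e) π∈ with ∈-++⁻ (map (block s true e ++_) X) π∈
  ... | inj₁ π∈T = let π′ , π′∈X , eq = ∈-map⁻ (block s true e ++_) π∈T in true , e , π′ , eq , refl , π′∈X
  ... | inj₂ π∈F = let π′ , π′∈X , eq = ∈-map⁻ (block s false (suc e) ++_) π∈F in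
                   false , suc e , π′ , eq , refl , π′∈X

  ∈-withBlocks⁺ : ∀ s X b c {π′} → π′ ∈ X → block s b c ++ π′ ∈ withBlocks s X (toℕ b + c)
  ∈-withBlocks⁺ s X true  c       π′∈X = ∈-++⁺ˡ (∈-map⁺ (block s true c ++_) π′∈X)
  ∈-withBlocks⁺ s X false zero    π′∈X = π′∈X
  ∈-withBlocks⁺ s X false (suc c) π′∈X =
    ∈-++⁺ʳ (map (block s true c ++_) X) (∈-map⁺ (block s false (suc c) ++_) π′∈X)

  -- If X m lists the overpartitions of m with parts at most N, these are the overpartitions
  -- of n with parts at most suc N and exactly e parts of size suc N.
  layer : (ℕ → List RawOP) → ℕ → ℕ → ℕ → List RawOP
  layer X N n e = if suc N * e ≤ᵇ n then withBlocks (suc N) (X (n ℕ.∸ suc N * e)) e else []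

  overpartitions : ℕ → ℕ → List RawOP
  overpartitions zero    zero    = [] ∷ []
  overpartitions zero    (suc _) = []
  overpartitions (suc N) n       = concatTo n (layer (overpartitions N) N n)

  ∈-layer⁻ : ∀ X N n e {π} → π ∈ layer X N n e → suc N * e ≤ n × π ∈ withBlocks (suc N) (X (n ℕ.∸ suc N * e)) e
  ∈-layer⁻ X N n e π∈ with suc N * e ≤ᵇ n in le
  ... | true = ℕₚ.≤ᵇ⇒≤ _ _ (subst T (sym le) tt) , π∈

  ∈-layer⁺ : ∀ X N n e {π} → suc N * e ≤ n → π ∈ withBlocks (suc N) (X (n ℕ.∸ suc N * e)) e → π ∈ layer X N n e
  ∈-layer⁺ X N n e sNe≤n π∈ rewrite dec-true (suc N * e ℕ.≤? n) sNe≤n = π∈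

  ∈-overpartitions-suc⁻ : ∀ N n {π} → π ∈ overpartitions (suc N) n →
    Σ[ b ∈ Bool ] Σ[ c ∈ ℕ ] Σ[ π′ ∈ RawOP ] π ≡ block (suc N) b c ++ π′ ×
      suc N * (toℕ b + c) ≤ n × π′ ∈ overpartitions N (n ℕ.∸ suc N * (toℕ b + c))
  ∈-overpartitions-suc⁻ N n π∈ =
    let e , _ , π∈layer = ∈-concatTo⁻ n (layer (overpartitions N) N n) π∈
        sNe≤n , π∈blocks = ∈-layer⁻ (overpartitions N) N n e π∈layer
        b , c , π′ , eq , b+c≡e , π′∈ = ∈-withBlocks⁻ (suc N) _ e π∈blocks in
    b , c , π′ , eq , subst (λ e → suc N * e ≤ n) (sym b+c≡e) sNe≤n ,
    subst (λ e → π′ ∈ overpartitions N (n ℕ.∸ suc N * e)) (sym b+c≡e) π′∈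

  overpartitions-sound : ∀ N n {π} → π ∈ overpartitions N n →
    IsOverpartition π × size π ≡ n × FirstAtMost N π
  overpartitions-sound zero    zero    (here refl) = tt , refl , tt
  overpartitions-sound (suc N) n       π∈ with ∈-overpartitions-suc⁻ N n π∈
  ... | b , c , π′ , refl , sNe≤n , π′∈ =
    let v , size≡ , π′≤N = overpartitions-sound N _ π′∈
        v′ , π≤1+N = block-++-valid N b c π′ v π′≤N in
    v′ , size≡n size≡ , π≤1+N
    where
    e = toℕ b + c
    size≡n : size π′ ≡ n ℕ.∸ suc N * e → size (block (suc N) b c ++ π′) ≡ n
    size≡n size≡ = begin
      size (block (suc N) b c ++ π′)  ≡⟨ size-block-++ (suc N) b c π′ ⟩
      suc N * e + size π′             ≡⟨ cong (_+_ (suc N * e)) size≡ ⟩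
      suc N * e + (n ℕ.∸ suc N * e)   ≡⟨ ℕₚ.m+[n∸m]≡n sNe≤n ⟩
      n                               ∎

  overpartitions-valid : ∀ N n {π} → π ∈ overpartitions N n → IsOverpartition π × FirstAtMost N π
  overpartitions-valid N n π∈ = let v , _ , π≤N = overpartitions-sound N n π∈ in v , π≤N

  overpartitions-complete : ∀ N n π → IsOverpartition π → size π ≡ n → FirstAtMost N π →
    π ∈ overpartitions N n
  overpartitions-complete zero    n []              _ refl _   = here refl
  overpartitions-complete zero    n ((s , b) ∷ ρ)  v _    s≤0 =
    ⊥-elim (ℕₚ.<⇒≱ (proj₁ (IsOverpartition-∷⁻ ρ v)) s≤0)
  overpartitions-complete (suc N) n π v size≡n π≤1+N with block-prefix N π v π≤1+N
  ... | b , c , π′ , refl , π′≤N , v′ =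
    ∈-concatTo⁺ n (layer (overpartitions N) N n) e≤n (∈-layer⁺ (overpartitions N) N n e sNe≤n
      (∈-withBlocks⁺ (suc N) _ b c (overpartitions-complete N _ π′ v′ size′ π′≤N)))
    where
    e = toℕ b + c
    n≡ : n ≡ suc N * e + size π′
    n≡ = trans (sym size≡n) (size-block-++ (suc N) b c π′)
    sNe≤n : suc N * e ≤ n
    sNe≤n = subst (suc N * e ≤_) (sym n≡) (ℕₚ.m≤m+n _ _)
    e≤n : e ≤ n
    e≤n = ℕₚ.≤-trans (ℕₚ.m≤n*m e (suc N)) sNe≤n
    size′ : size π′ ≡ n ℕ.∸ suc N * e
    size′ = sym (trans (cong (ℕ._∸ suc N * e) n≡) (ℕₚ.m+n∸m≡n (suc N * e) (size π′)))

  numParts : ℕ → RawOP → ℕ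
  numParts s π = cnt s true π + cnt s false π

  numParts-layer : ∀ N n e {π} → π ∈ layer (overpartitions N) N n e → numParts (suc N) π ≡ e
  numParts-layer N n e {π} π∈ =
    let _ , π∈blocks = ∈-layer⁻ (overpartitions N) N n e π∈
        b , c , π′ , eq , b+c≡e , π′∈ = ∈-withBlocks⁻ (suc N) _ e π∈blocks
        v , π′≤N = overpartitions-valid N _ π′∈ in
    begin
      numParts (suc N) π                                 ≡⟨ cong (numParts (suc N)) eq ⟩
      numParts (suc N) (block (suc N) b c ++ π′)         ≡⟨ cong₂ _+_ (cnt-block-++-true N b c π′ v π′≤N)
                                                                      (cnt-block-++-false N b c π′ v π′≤N) ⟩
      toℕ b + c                                          ≡⟨ b+c≡e ⟩
      e                                                  ∎

  withBlocks-unique : ∀ N X e → Unique X → (∀ {π} → π ∈ X → IsOverpartition π × FirstAtMost N π) →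
    Unique (withBlocks (suc N) X e)
  withBlocks-unique N X zero    !X _     = !X
  withBlocks-unique N X (suc e) !X valid =
    Unique.++⁺ (Unique.map⁺ (++-cancelˡ (block (suc N) true e) _ _) !X)
               (Unique.map⁺ (++-cancelˡ (block (suc N) false (suc e)) _ _) !X) disjoint
    where
    disjoint : ∀ {π} → ¬ (π ∈ map (block (suc N) true e ++_) X × π ∈ map (block (suc N) false (suc e) ++_) X)
    disjoint (π∈T , π∈F) =
      let π₁ , π₁∈X , eq₁ = ∈-map⁻ (block (suc N) true e ++_) π∈T
          π₂ , π₂∈X , eq₂ = ∈-map⁻ (block (suc N) false (suc e) ++_) π∈F
          v₁ , π₁≤N = valid π₁∈X
          v₂ , π₂≤N = valid π₂∈X in
      ℕₚ.1+n≢0 (begin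
        1                                                   ≡⟨ cnt-block-++-true N true e π₁ v₁ π₁≤N ⟨
        cnt (suc N) true (block (suc N) true e ++ π₁)       ≡⟨ cong (cnt (suc N) true) (trans (sym eq₁) eq₂) ⟩
        cnt (suc N) true (block (suc N) false (suc e) ++ π₂) ≡⟨ cnt-block-++-true N false (suc e) π₂ v₂ π₂≤N ⟩
        0                                                   ∎)

  overpartitions-unique : ∀ N n → Unique (overpartitions N n)
  overpartitions-unique zero    zero    = [] ∷ []
  overpartitions-unique zero    (suc n) = []
  overpartitions-unique (suc N) n       =
    concatTo-unique n (layer (overpartitions N) N n) (numParts (suc N)) (numParts-layer N n) layer-unique
    where
    layer-unique : ∀ e → Unique (layer (overpartitions N) N n e)
    layer-unique e with suc N * e ≤ᵇ n
    ... | true  = withBlocks-unique N _ e (overpartitions-unique N _) (overpartitions-valid N _)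
    ... | false = []

open Enumeration

module Counting (r′ : ℕ) where

  open import Data.Nat as ℕ using (ℕ; zero; suc; _+_; _*_; _≤_; _≡ᵇ_; _<ᵇ_; _≤ᵇ_)
  import Data.Nat.Properties as ℕₚ
  open import Data.Integer as ℤ using (+_)
  import Data.Integer.Properties as ℤₚ
  open import Data.Bool using (Bool; true; false; if_then_else_; _∧_; _∨_; not)
  open import Data.Bool.Properties using (∧-assoc; ∧-comm; ∧-idem; ∧-identityʳ; ∨-identityʳ; ∨-zeroʳ)
  open import Relation.Nullary using (yes; no)
  open import Relation.Nullary.Decidable using (dec-true; dec-false)
  open import Data.Product using (_×_; _,_)
  open import Data.List using (List; _++_; map)
  open import Data.List.Membership.Propositional using (_∈_)
  open import Function using (_∘_)
  open ≡-Reasoning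

  r : ℕ
  r = suc r′

  open ProductFormula r

  saturatedBy : ℕ → ℕ → Bool
  saturatedBy o p = not ((o ≡ᵇ 0) ∨ (p <ᵇ r′))

  -- This is not (qualifies r t π): π has an overlined part t and at least r − 1 plain parts t.
  saturated : ℕ → RawOP → Bool
  saturated t π = saturatedBy (cnt t true π) (cnt t false π)

  saturatedOn : (ℕ → Bool) → ℕ → RawOP → Bool
  saturatedOn S zero    π = true
  saturatedOn S (suc N) π = saturatedOn S N π ∧ (if S (suc N) then saturated (suc N) π else true)

  saturatedOn-cong : ∀ S S′ N {π ρ} →
    (∀ t → suc t ≤ N → (if S (suc t) then saturated (suc t) π else true)
                     ≡ (if S′ (suc t) then saturated (suc t) ρ else true)) →
    saturatedOn S N π ≡ saturatedOn S′ N ρ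
  saturatedOn-cong S S′ zero    _  = refl
  saturatedOn-cong S S′ (suc N) eq =
    cong₂ _∧_ (saturatedOn-cong S S′ N (λ t t<N → eq t (ℕₚ.m≤n⇒m≤1+n t<N))) (eq N ℕₚ.≤-refl)

  saturatedOn-none : ∀ N π → saturatedOn (λ _ → false) N π ≡ true
  saturatedOn-none zero    π = refl
  saturatedOn-none (suc N) π = trans (∧-identityʳ _) (saturatedOn-none N π)

  saturatedOn-extend : ∀ S u N π → suc u ≤ N →
    saturatedOn (λ t → S t ∨ (t ≡ᵇ suc u)) N π ≡ saturatedOn S N π ∧ saturated (suc u) π
  saturatedOn-extend S u (suc N) π u<1+N with N ℕ.≟ u
  ... | yes N≡u = begin
    saturatedOn S′ N π ∧ (if S (suc N) ∨ (N ≡ᵇ u) then sat (suc N) else true)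
      ≡⟨ cong₂ _∧_ (saturatedOn-cong S′ S N below) (cong (if_then sat (suc N) else true) top) ⟩
    saturatedOn S N π ∧ sat (suc N)
      ≡⟨ absorb (saturatedOn S N π) (S (suc N)) (sat (suc N)) ⟩
    (saturatedOn S N π ∧ (if S (suc N) then sat (suc N) else true)) ∧ sat (suc N)
      ≡⟨ cong (λ x → (saturatedOn S N π ∧ (if S (suc N) then sat (suc N) else true)) ∧ sat (suc x)) N≡u ⟩
    (saturatedOn S N π ∧ (if S (suc N) then sat (suc N) else true)) ∧ sat (suc u) ∎
    where
    S′ = λ t → S t ∨ (t ≡ᵇ suc u)
    sat = λ t → saturated t π
    below : ∀ t → suc t ≤ N →
      (if S′ (suc t) then sat (suc t) else true) ≡ (if S (suc t) then sat (suc t) else true)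
    below t t<N = cong (if_then sat (suc t) else true)
      (trans (cong (S (suc t) ∨_) (dec-false (t ℕ.≟ u) (λ t≡u → ℕₚ.<-irrefl (trans t≡u (sym N≡u)) t<N)))
             (∨-identityʳ (S (suc t))))
    top : S (suc N) ∨ (N ≡ᵇ u) ≡ true
    top = trans (cong (S (suc N) ∨_) (dec-true (N ℕ.≟ u) N≡u)) (∨-zeroʳ (S (suc N)))
    absorb : ∀ x b s → x ∧ s ≡ (x ∧ (if b then s else true)) ∧ s
    absorb x true  s = trans (cong (x ∧_) (sym (∧-idem s))) (sym (∧-assoc x s s))
    absorb x false s = cong (_∧ s) (sym (∧-identityʳ x))
  ... | no N≢u = begin
    saturatedOn S′ N π ∧ (if S (suc N) ∨ (N ≡ᵇ u) then sat (suc N) else true)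
      ≡⟨ cong₂ _∧_ (saturatedOn-extend S u N π u<N) (cong (if_then sat (suc N) else true) top) ⟩
    (saturatedOn S N π ∧ sat (suc u)) ∧ (if S (suc N) then sat (suc N) else true)
      ≡⟨ ∧-swap (saturatedOn S N π) (sat (suc u)) _ ⟩
    (saturatedOn S N π ∧ (if S (suc N) then sat (suc N) else true)) ∧ sat (suc u) ∎
    where
    S′ = λ t → S t ∨ (t ≡ᵇ suc u)
    sat = λ t → saturated t π
    u<N : suc u ≤ N
    u<N = ℕₚ.≤-pred (ℕₚ.≤∧≢⇒< u<1+N (λ eq → N≢u (sym (ℕₚ.suc-injective eq))))
    top : S (suc N) ∨ (N ≡ᵇ u) ≡ S (suc N)
    top = trans (cong (S (suc N) ∨_) (dec-false (N ℕ.≟ u) N≢u)) (∨-identityʳ (S (suc N)))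
    ∧-swap : ∀ x y z → (x ∧ y) ∧ z ≡ (x ∧ z) ∧ y
    ∧-swap x y z = trans (∧-assoc x y z) (trans (cong (x ∧_) (∧-comm y z)) (sym (∧-assoc x z y)))

  -- Whether the parts of size t of a π counted by saturatedOn S may be block t b c.
  admissible : Bool → Bool → ℕ → Bool
  admissible selected b c = if selected then saturatedBy (toℕ b) c else true

  saturatedOn-block-++ : ∀ S N b c π → IsOverpartition π → FirstAtMost N π →
    saturatedOn S (suc N) (block (suc N) b c ++ π) ≡ saturatedOn S N π ∧ admissible (S (suc N)) b c
  saturatedOn-block-++ S N b c π v π≤N = cong₂ _∧_
    (saturatedOn-cong S S N (λ t t<N → cong (if S (suc t) then_else true) (cong₂ saturatedBy
      (cnt-block-++-≢ true b c π (1+t≢1+N t<N)) (cnt-block-++-≢ false b c π (1+t≢1+N t<N)))))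
    (cong (if S (suc N) then_else true)
      (cong₂ saturatedBy (cnt-block-++-true N b c π v π≤N) (cnt-block-++-false N b c π v π≤N)))
    where
    1+t≢1+N : ∀ {t} → suc t ≤ N → suc N ≢ suc t
    1+t≢1+N t<N eq = ℕₚ.<-irrefl (sym eq) (ℕ.s≤s t<N)

  admissibleBlocks : Bool → ℕ → ℕ
  admissibleBlocks selected zero    = toℕ (admissible selected false 0)
  admissibleBlocks selected (suc e) = toℕ (admissible selected true e) + toℕ (admissible selected false (suc e))

  not-<ᵇ : ∀ m n → not (m <ᵇ n) ≡ (n <ᵇ suc m)
  not-<ᵇ m       zero    = refl
  not-<ᵇ zero    (suc n) = refl
  not-<ᵇ (suc m) (suc n) = not-<ᵇ m n

  admissibleBlocks-weight : ∀ selected e → + admissibleBlocks selected e ≡ weight selected e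
  admissibleBlocks-weight false zero    = refl
  admissibleBlocks-weight false (suc e) = refl
  admissibleBlocks-weight true  zero    = refl
  admissibleBlocks-weight true  (suc e) rewrite not-<ᵇ e r′ with r′ <ᵇ suc e
  ... | true  = refl
  ... | false = refl

  count-withBlocks : ∀ S N X e → (∀ {π} → π ∈ X → IsOverpartition π × FirstAtMost N π) →
    count (saturatedOn S (suc N)) (withBlocks (suc N) X e)
      ≡ count (saturatedOn S N) X * admissibleBlocks (S (suc N)) e
  count-withBlocks S N X zero valid =
    trans (count-cong X (λ π π∈X → let v , π≤N = valid π∈X in saturatedOn-block-++ S N false 0 π v π≤N))
          (count-∧ʳ (saturatedOn S N) _ X)
  count-withBlocks S N X (suc e) valid = begin
    count sat (map (block (suc N) true e ++_) X ++ map (block (suc N) false (suc e) ++_) X)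
      ≡⟨ count-++ sat (map (block (suc N) true e ++_) X) _ ⟩
    count sat (map (block (suc N) true e ++_) X) + count sat (map (block (suc N) false (suc e) ++_) X)
      ≡⟨ cong₂ _+_ (with-block true e) (with-block false (suc e)) ⟩
    count (saturatedOn S N) X * toℕ (ok true e) + count (saturatedOn S N) X * toℕ (ok false (suc e))
      ≡⟨ ℕₚ.*-distribˡ-+ (count (saturatedOn S N) X) (toℕ (ok true e)) _ ⟨
    count (saturatedOn S N) X * admissibleBlocks (S (suc N)) (suc e) ∎
    where
    sat = saturatedOn S (suc N)
    ok = admissible (S (suc N))
    with-block : ∀ b c → count sat (map (block (suc N) b c ++_) X) ≡ count (saturatedOn S N) X * toℕ (ok b c)
    with-block b c = begin
      count sat (map (block (suc N) b c ++_) X)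
        ≡⟨ count-map sat (block (suc N) b c ++_) X ⟩
      count (sat ∘ (block (suc N) b c ++_)) X
        ≡⟨ count-cong X (λ π π∈X → let v , π≤N = valid π∈X in saturatedOn-block-++ S N b c π v π≤N) ⟩
      count (λ π → saturatedOn S N π ∧ ok b c) X
        ≡⟨ count-∧ʳ (saturatedOn S N) (ok b c) X ⟩
      count (saturatedOn S N) X * toℕ (ok b c) ∎

  count-saturatedOn : ∀ S N n → + count (saturatedOn S N) (overpartitions N n) ≡ prodFrom1 (factor S) N n
  count-saturatedOn S zero    zero    = refl
  count-saturatedOn S zero    (suc n) = refl
  count-saturatedOn S (suc N) n = begin
    + count (saturatedOn S (suc N)) (concatTo n (layer (overpartitions N) N n))
      ≡⟨ count-concatTo n (saturatedOn S (suc N)) (layer (overpartitions N) N n) ⟩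
    sumTo n (λ e → + count (saturatedOn S (suc N)) (layer (overpartitions N) N n e))
      ≡⟨ sumTo-cong n (λ e _ → count-layer e) ⟩
    sumTo n (λ e → if suc N * e ≤ᵇ n then weight (S (suc N)) e ℤ.* P (n ℕ.∸ suc N * e) else + 0)
      ≡⟨ onMultiples-⊛ N (weight (S (suc N))) P n ⟨
    (factor S (suc N) ⊛ P) n
      ≡⟨ ⊛-comm (factor S (suc N)) P n ⟩
    prodFrom1 (factor S) (suc N) n ∎
    where
    P = prodFrom1 (factor S) N
    count-layer : ∀ e → + count (saturatedOn S (suc N)) (layer (overpartitions N) N n e)
                      ≡ (if suc N * e ≤ᵇ n then weight (S (suc N)) e ℤ.* P (n ℕ.∸ suc N * e) else + 0)
    count-layer e with suc N * e ≤ᵇ n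
    ... | false = refl
    ... | true  = begin
      + count (saturatedOn S (suc N)) (withBlocks (suc N) X e)
        ≡⟨ cong +_ (count-withBlocks S N X e (overpartitions-valid N _)) ⟩
      + (count (saturatedOn S N) X * admissibleBlocks (S (suc N)) e)
        ≡⟨ ℤₚ.pos-* (count (saturatedOn S N) X) (admissibleBlocks (S (suc N)) e) ⟩
      + count (saturatedOn S N) X ℤ.* + admissibleBlocks (S (suc N)) e
        ≡⟨ ℤₚ.*-comm (+ count (saturatedOn S N) X) _ ⟩
      + admissibleBlocks (S (suc N)) e ℤ.* + count (saturatedOn S N) X
        ≡⟨ cong₂ ℤ._*_ (admissibleBlocks-weight (S (suc N)) e) (count-saturatedOn S N (n ℕ.∸ suc N * e)) ⟩
      weight (S (suc N)) e ℤ.* P (n ℕ.∸ suc N * e) ∎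
      where X = overpartitions N (n ℕ.∸ suc N * e)

module MinimalExcludant (A′ a′ r′ : ℕ) where

  open import Data.Nat as ℕ using (ℕ; zero; suc; _+_; _*_; _≤_; _<_; _≡ᵇ_; _≤ᵇ_; z≤n; s≤s)
  import Data.Nat.Properties as ℕₚ
  open import Data.Nat.Divisibility using (divides; _∣?_)
  open import Data.Integer as ℤ using (ℤ; +_)
  import Data.Integer.Properties as ℤₚ
  open import Data.Integer.Tactic.RingSolver using (solve-∀)
  open import Data.Bool using (Bool; true; false; _∧_; not)
  open import Data.Empty using (⊥-elim)
  open import Data.Sum using (_⊎_; inj₁; inj₂; map₂)
  open import Data.Product using (Σ-syntax; _×_; _,_; proj₁; proj₂)
  open import Data.List using (List)
  open import Data.List.Membership.Propositional using (_∈_)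
  open import Data.List.Relation.Unary.Unique.Propositional using (Unique)
  open import Relation.Nullary using (yes; no)
  open import Relation.Nullary.Decidable using (dec-true; dec-false)
  open import Relation.Binary.Definitions using (tri<; tri≈; tri>)
  open import Function using (_∘_)
  open ≡-Reasoning

  open Counting r′
  open Progression A′ a′ r

  findK-spec : ∀ π fuel k₀ → let R = findK r A a fuel π k₀ in
    k₀ ≤ R × (∀ j → k₀ ≤ j → j < R → qualifies r (prog j) π ≡ false) ×
    (qualifies r (prog R) π ≡ true ⊎ R ≡ k₀ + fuel)
  findK-spec π zero       k₀ =
    ℕₚ.≤-refl , (λ j k₀≤j j<k₀ → ⊥-elim (ℕₚ.<⇒≱ j<k₀ k₀≤j)) , inj₂ (sym (ℕₚ.+-identityʳ k₀))
  findK-spec π (suc fuel) k₀ with qualifies r (prog k₀) π in q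
  ... | true  = ℕₚ.≤-refl , (λ j k₀≤j j<k₀ → ⊥-elim (ℕₚ.<⇒≱ j<k₀ k₀≤j)) , inj₁ q
  ... | false =
    let k₀<R , skipped , stop = findK-spec π fuel (suc k₀) in
    ℕₚ.<⇒≤ k₀<R , skipped′ skipped , map₂ (λ R≡ → trans R≡ (sym (ℕₚ.+-suc k₀ fuel))) stop
    where
    skipped′ : (∀ j → suc k₀ ≤ j → j < findK r A a fuel π (suc k₀) → qualifies r (prog j) π ≡ false) →
               ∀ j → k₀ ≤ j → j < findK r A a fuel π (suc k₀) → qualifies r (prog j) π ≡ false
    skipped′ skipped j k₀≤j j<R with j ℕ.≟ k₀
    ... | yes refl = q
    ... | no j≢k₀  = skipped j (ℕₚ.≤∧≢⇒< k₀≤j (j≢k₀ ∘ sym)) j<R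

  -- mes r A a π is prog (firstQualifying π) by definition.
  firstQualifying : RawOP → ℕ
  firstQualifying π = findK r A a (suc (size π)) π 0

  firstQualifying-minimal : ∀ π j → j < firstQualifying π → saturated (prog j) π ≡ true
  firstQualifying-minimal π j j<R = cong not (proj₁ (proj₂ (findK-spec π (suc (size π)) 0)) j z≤n j<R)

  n<prog-suc : ∀ n → n < prog (suc n)
  n<prog-suc n = ℕₚ.≤-trans (ℕₚ.m≤m*n (suc n) A) (ℕₚ.m≤n+m _ a)

  -- If the fuel runs out, prog (suc (size π)) exceeds every part, hence qualifies.
  firstQualifying-qualifies : ∀ π → saturated (prog (firstQualifying π)) π ≡ false
  firstQualifying-qualifies π with proj₂ (proj₂ (findK-spec π (suc (size π)) 0))
  ... | inj₁ q    = cong not q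
  ... | inj₂ R≡1+size rewrite R≡1+size | cnt-beyond-size true π (n<prog-suc (size π)) = refl

  ≤ᵇ-firstQualifying-suc : ∀ π k →
    (suc k ≤ᵇ firstQualifying π) ≡ (k ≤ᵇ firstQualifying π) ∧ saturated (prog k) π
  ≤ᵇ-firstQualifying-suc π k with ℕₚ.<-cmp k (firstQualifying π)
  ... | tri< k<R _ _
    rewrite dec-true (suc k ℕ.≤? firstQualifying π) k<R | dec-true (k ℕ.≤? firstQualifying π) (ℕₚ.<⇒≤ k<R)
          | firstQualifying-minimal π k k<R = refl
  ... | tri≈ _ refl _
    rewrite dec-false (suc k ℕ.≤? k) (ℕₚ.<-irrefl refl) | dec-true (k ℕ.≤? k) ℕₚ.≤-refl
          | firstQualifying-qualifies π = refl
  ... | tri> _ _ R<k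
    rewrite dec-false (suc k ℕ.≤? firstQualifying π) (ℕₚ.<⇒≱ (ℕₚ.m<n⇒m<1+n R<k))
          | dec-false (k ℕ.≤? firstQualifying π) (ℕₚ.<⇒≱ R<k) = refl

  saturatedOn-inProg : ∀ k N π → (∀ j → j < k → prog j ≤ N) →
    saturatedOn (inProg k) N π ≡ (k ≤ᵇ firstQualifying π)
  saturatedOn-inProg zero    N π _      = saturatedOn-none N π
  saturatedOn-inProg (suc k) N π prog<N = begin
    saturatedOn (inProg (suc k)) N π
      ≡⟨ saturatedOn-extend (inProg k) (a′ + k * A) N π (prog<N k ℕₚ.≤-refl) ⟩
    saturatedOn (inProg k) N π ∧ saturated (prog k) π
      ≡⟨ cong (_∧ saturated (prog k) π) (saturatedOn-inProg k N π (λ j j<k → prog<N j (ℕₚ.m≤n⇒m≤1+n j<k))) ⟩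
    (k ≤ᵇ firstQualifying π) ∧ saturated (prog k) π
      ≡⟨ ≤ᵇ-firstQualifying-suc π k ⟨
    (suc k ≤ᵇ firstQualifying π) ∎

  mes≡ᵇ : ∀ π k → (mes r A a π ≡ᵇ k * A + a) ≡ (firstQualifying π ≡ᵇ k)
  mes≡ᵇ π k with firstQualifying π ℕ.≟ k
  ... | yes R≡k rewrite dec-true (firstQualifying π ℕ.≟ k) R≡k =
    dec-true (mes r A a π ℕ.≟ k * A + a) (trans (cong prog R≡k) (ℕₚ.+-comm a (k * A)))
  ... | no R≢k rewrite dec-false (firstQualifying π ℕ.≟ k) R≢k =
    dec-false (mes r A a π ℕ.≟ k * A + a) (λ eq → R≢k (prog-injective _ k (trans eq (ℕₚ.+-comm (k * A) a))))

  ≡ᵇ-+-≤ᵇ : ∀ R k → toℕ (R ≡ᵇ k) + toℕ (suc k ≤ᵇ R) ≡ toℕ (k ≤ᵇ R)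
  ≡ᵇ-+-≤ᵇ zero    zero          = refl
  ≡ᵇ-+-≤ᵇ zero    (suc k)       = refl
  ≡ᵇ-+-≤ᵇ (suc R) zero          = refl
  ≡ᵇ-+-≤ᵇ (suc R) (suc zero)    = ≡ᵇ-+-≤ᵇ R zero
  ≡ᵇ-+-≤ᵇ (suc R) (suc (suc k)) = ≡ᵇ-+-≤ᵇ R (suc k)

  mes-telescopes : ∀ k π →
    toℕ (mes r A a π ≡ᵇ k * A + a) + toℕ (suc k ≤ᵇ firstQualifying π) ≡ toℕ (k ≤ᵇ firstQualifying π)
  mes-telescopes k π rewrite mes≡ᵇ π k = ≡ᵇ-+-≤ᵇ (firstQualifying π) k

  inProgression? : ∀ m → (Σ[ k ∈ ℕ ] k * A + a ≡ m) ⊎ (∀ k → k * A + a ≢ m)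
  inProgression? m with a ℕ.≤? m | A ∣? (m ℕ.∸ a)
  ... | yes a≤m | yes (divides k m∸a≡kA) = inj₁ (k , trans (cong (_+ a) (sym m∸a≡kA)) (ℕₚ.m∸n+n≡m a≤m))
  ... | yes a≤m | no A∤m∸a =
    inj₂ λ k eq → A∤m∸a (divides k (trans (cong (ℕ._∸ a) (sym eq)) (ℕₚ.m+n∸n≡m (k * A) a)))
  ... | no a≰m  | _        = inj₂ λ k eq → a≰m (subst (a ≤_) eq (ℕₚ.m≤n+m a (k * A)))

  open ProductFormula r using (factor)

  module _ (n : ℕ) (L : List RawOP) (!L : Unique L)
           (L-sound : ∀ π → π ∈ L → IsOverpartition π × size π ≡ n)
           (L-complete : ∀ π → IsOverpartition π → size π ≡ n → π ∈ L) where

    count-≤ᵇ-firstQualifying : ∀ k →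
      + count (λ π → k ≤ᵇ firstQualifying π) L ≡ ((minusQInf ⊛ invQInf) ⊛ Dterm r A a k) n
    count-≤ᵇ-firstQualifying k = begin
      + count (λ π → k ≤ᵇ firstQualifying π) L
        ≡⟨ cong +_ (count-unique _ !L (overpartitions-unique N n) L⊆ ⊆L) ⟩
      + count (λ π → k ≤ᵇ firstQualifying π) (overpartitions N n)
        ≡⟨ cong +_ (count-cong (overpartitions N n) (λ π _ → sym (saturatedOn-inProg k N π prog<N))) ⟩
      + count (saturatedOn (inProg k) N) (overpartitions N n)
        ≡⟨ count-saturatedOn (inProg k) N n ⟩
      prodFrom1 (factor (inProg k)) N n
        ≡⟨ prodFrom1-factor-≗[] k N prog<N n (ℕₚ.m≤m+n n (prog k)) ⟩
      ((minusQInf ⊛ invQInf) ⊛ Dterm r A a k) n ∎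
      where
      -- Large enough for every part of π and for all prog j, j < k.
      N = n + prog k
      prog<N : ∀ j → j < k → prog j ≤ N
      prog<N j j<k = ℕₚ.≤-trans (ℕₚ.+-monoʳ-≤ a (ℕₚ.*-monoˡ-≤ A (ℕₚ.<⇒≤ j<k))) (ℕₚ.m≤n+m (prog k) n)
      L⊆ : ∀ π → π ∈ L → π ∈ overpartitions N n
      L⊆ π π∈L = let v , size≡n = L-sound π π∈L in
        overpartitions-complete N n π v size≡n
          (FirstAtMost-mono π (ℕₚ.≤-trans (ℕₚ.≤-reflexive size≡n) (ℕₚ.m≤m+n n (prog k))) (FirstAtMost-size π))
      ⊆L : ∀ π → π ∈ overpartitions N n → π ∈ L
      ⊆L π π∈ = let v , size≡n , _ = overpartitions-sound N n π∈ in L-complete π v size≡n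

    count-mes : ∀ k → + count (λ π → mes r A a π ≡ᵇ k * A + a) L ≡ rhsTerm r A a k n
    count-mes k = begin
      + count mes≡ L
        ≡⟨ ℤ-+-∸ (count mes≡ L) (count above L) ⟩
      + (count mes≡ L + count above L) ℤ.- + count above L
        ≡⟨ cong (λ x → + x ℤ.- + count above L) (count-+ mes≡ above atLeast L (mes-telescopes k)) ⟩
      + count atLeast L ℤ.- + count above L
        ≡⟨ cong₂ ℤ._-_ (count-≤ᵇ-firstQualifying k)
                       (count-≤ᵇ-firstQualifying (suc k)) ⟩
      ((minusQInf ⊛ invQInf) ⊛ Dterm r A a k) n ℤ.- ((minusQInf ⊛ invQInf) ⊛ Dterm r A a (suc k)) n
        ≡⟨ ⊛-distribˡ-⊖ (minusQInf ⊛ invQInf) (Dterm r A a k) (Dterm r A a (suc k)) n ⟨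
      rhsTerm r A a k n ∎
      where
      mes≡ atLeast above : RawOP → Bool
      mes≡ π = mes r A a π ≡ᵇ k * A + a
      atLeast π = k ≤ᵇ firstQualifying π
      above π = suc k ≤ᵇ firstQualifying π
      ℤ-+-∸ : ∀ x y → + x ≡ + (x + y) ℤ.- + y
      ℤ-+-∸ x y rewrite ℤₚ.pos-+ x y = cancel (+ x) (+ y)
        where
        cancel : ∀ (x y : ℤ) → x ≡ x ℤ.+ y ℤ.- y
        cancel = solve-∀

    count-mes-distribution : ∀ m →
      + count (λ π → mes r A a π ≡ᵇ m) L ≡ sumTo m (λ k → δ (k * A + a) m ℤ.* rhsTerm r A a k n)
    count-mes-distribution m with inProgression? m
    ... | inj₁ (k , refl) = begin
      + count (λ π → mes r A a π ≡ᵇ k * A + a) L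
        ≡⟨ count-mes k ⟩
      rhsTerm r A a k n
        ≡⟨ ℤₚ.*-identityˡ _ ⟨
      + 1 ℤ.* rhsTerm r A a k n
        ≡⟨ cong (ℤ._* rhsTerm r A a k n) (δ-refl (k * A + a)) ⟨
      δ (k * A + a) (k * A + a) ℤ.* rhsTerm r A a k n
        ≡⟨ sumTo-single (k * A + a) k (ℕₚ.≤-trans (ℕₚ.m≤m*n k A) (ℕₚ.m≤m+n _ a)) other ⟨
      sumTo (k * A + a) (λ j → δ (j * A + a) (k * A + a) ℤ.* rhsTerm r A a j n) ∎
      where
      other : ∀ j → j ≤ k * A + a → j ≢ k → δ (j * A + a) (k * A + a) ℤ.* rhsTerm r A a j n ≡ + 0
      other j _ j≢k = trans (cong (ℤ._* rhsTerm r A a j n)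
        (δ-≢ (j * A + a) (k * A + a) (λ eq → j≢k (ℕₚ.*-cancelʳ-≡ j k A (ℕₚ.+-cancelʳ-≡ a (j * A) (k * A) eq)))))
        (ℤₚ.*-zeroˡ (rhsTerm r A a j n))
    ... | inj₂ m∉ = begin
      + count (λ π → mes r A a π ≡ᵇ m) L                  ≡⟨ cong +_ (count-≡0 L (λ π _ → mes≢m π)) ⟩
      + 0                                                 ≡⟨ sumTo-zero m (λ k _ → term≡0 k) ⟨
      sumTo m (λ k → δ (k * A + a) m ℤ.* rhsTerm r A a k n) ∎
      where
      mes≢m : ∀ π → (mes r A a π ≡ᵇ m) ≡ false
      mes≢m π = dec-false (mes r A a π ℕ.≟ m)
        (λ eq → m∉ (firstQualifying π) (trans (ℕₚ.+-comm (firstQualifying π * A) a) eq))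
      term≡0 : ∀ k → δ (k * A + a) m ℤ.* rhsTerm r A a k n ≡ + 0
      term≡0 k = trans (cong (ℤ._* rhsTerm r A a k n) (δ-≢ (k * A + a) m (m∉ k))) (ℤₚ.*-zeroˡ (rhsTerm r A a k n))

open MinimalExcludant using (count-mes-distribution)
open ListCounting using (length-filter)
open import Data.Nat using (_≤_; _*_; _+_; _≟_; suc; s≤s; z≤n)
open import Data.Integer using (+_)
open import Data.List using (List; length; filter)
open import Data.List.Membership.Propositional using (_∈_)
open import Data.List.Relation.Unary.Unique.Propositional using (Unique)
open import Data.Product using (_×_)

theorem2p5 : (A a r : ℕ) → 1 ≤ a → a ≤ A → 2 ≤ r →
    (n m : ℕ) (L : List RawOP) → Unique L →
    (∀ π → π ∈ L → IsOverpartition π × size π ≡ n) →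
    (∀ π → IsOverpartition π → size π ≡ n → π ∈ L) →
    + length (filter (λ π → mes r A a π ≟ m) L)
      ≡ sumTo m (λ k → δ (k * A + a) m Data.Integer.* rhsTerm r A a k n)
theorem2p5 (suc A′) (suc a′) (suc r′) (s≤s z≤n) (s≤s _) (s≤s (s≤s _)) n m L !L L-sound L-complete =
  trans (cong +_ (length-filter (λ π → mes (suc r′) (suc A′) (suc a′) π ≟ m) L))
        (count-mes-distribution A′ a′ r′ n L !L L-sound L-complete m)
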